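{- Let $\mathcal{A}\subseteq\{\mathsf{C},\mathsf{N},\mathsf{P},\mathsf{D},\mathsf{T},\mathsf{4}\}$. Then the linear nested sequent calculus $\mathsf{LNS}_{\mathsf{M}\mathcal{A}}$ extended with contraction and weakening is sound and complete for the logic $\mathsf{M}\mathcal{A}$: for every formula $A$, $A\in\mathsf{M}\mathcal{A}$ if and only if $\;\Rightarrow A$ is derivable in this calculus.
   Context: Formulas: propositional variables, $\bot,\top,\neg,\land,\lor,\to,\Box$. $\mathsf{M}\mathcal{A}$ is the smallest set of formulas containing all propositional tautologies, the axiom $\mathsf{M}: \Box(A\land B)\to(\Box A\land\Box B)$ and the axioms in $\mathcal{A}$, closed under modus ponens and the rule: from $A\to B$ and $B\to A$ infer $\Box A\to\Box B$; the axioms are $\mathsf{C}: (\Box A\land\Box B)\to\Box(A\land B)$, $\mathsf{N}: \Box\top$, $\mathsf{P}: \neg\Box\bot$, $\mathsf{D}: \neg(\Box A\land\Box\neg A)$, $\mathsf{T}: \Box A\to A$, $\mathsf{4}: \Box A\to\Box\Box A$. Structures: $\mathcal{X}::=\Gamma\Rightarrow\Delta\mid\Gamma\Rightarrow\Delta\,/_{\mathsf m}\,\Sigma\Rightarrow\Pi\mid\Gamma\Rightarrow\Delta\,/\,\mathcal{X}$ (finite multisets of formulas; the nesting $/_{\mathsf m}$ only at the end). $\mathcal{S}\{\Gamma\Rightarrow\Delta\}$ has a distinguished component; in rules below the displayed components are the last ones and $\mathcal{G}$ is a (possibly empty) prefix. $\mathsf{LNS}_{\mathsf{M}\mathcal{A}}$: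 propositional rules (zero-premiss $\mathcal{S}\{\Gamma,p\Rightarrow p,\Delta\}$ with $p$ atomic, $\mathcal{S}\{\Gamma,\bot\Rightarrow\Delta\}$, $\mathcal{S}\{\Gamma\Rightarrow\top,\Delta\}$, and the standard two-sided invertible rules for $\neg,\land,\lor,\to$ on one component), not applicable to the component after $/_{\mathsf m}$; $\Box^{\mathsf m}_R$: from $\mathcal{G}/\Gamma\Rightarrow\Delta/_{\mathsf m}\Rightarrow B$ infer $\mathcal{G}/\Gamma\Rightarrow\Box B,\Delta$; $\Box^{\mathsf m}_L$: from $\mathcal{G}/\Gamma\Rightarrow\Delta/\Sigma,A\Rightarrow\Pi$ infer $\mathcal{G}/\Gamma,\Box A\Rightarrow\Delta/_{\mathsf m}\Sigma\Rightarrow\Pi$; and for each element of $\mathcal{A}$ the rule: $\mathsf{C}$: from $\mathcal{G}/_{\mathsf m}\Gamma\Rightarrow\Delta$ infer $\mathcal{G}/\Gamma\Rightarrow\Delta$; $\mathsf{N}$: from $\mathcal{G}/\Gamma\Rightarrow\Delta$ infer $\mathcal{G}/_{\mathsf m}\Gamma\Rightarrow\Delta$; $\mathsf{P}$: from $\mathcal{G}/\Gamma\Rightarrow\Delta/_{\mathsf m}\Rightarrow\;$ infer $\mathcal{G}/\Gamma\Rightarrow\Delta$; $\mathsf{D}$: from $\mathcal{G}/\Gamma\Rightarrow\Delta/_{\mathsf m}A\Rightarrow\;$ infer $\mathcal{G}/\Gamma,\Box A\Rightarrow\Delta$; $\mathsf{T}$: from $\mathcal{G}/\Gamma\Rightarrow\Delta/_{\mathsf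 m}\Sigma\Rightarrow\Pi$ infer $\mathcal{G}/\Gamma,\Sigma\Rightarrow\Delta,\Pi$; $\mathsf{4}$: from $\mathcal{G}/\Gamma\Rightarrow\Delta/\Sigma,\Box A\Rightarrow\Pi$ infer $\mathcal{G}/\Gamma,\Box A\Rightarrow\Delta/_{\mathsf m}\Sigma\Rightarrow\Pi$. Contraction and weakening: usual left/right rules inside a component. -}

module Defs where

open import Data.Nat using (ℕ)
open import Data.Bool using (Bool; true; false; not; _∧_; _∨_)
open import Data.List using (List; []; _∷_; _++_; [_])
open import Data.List.Relation.Binary.Permutation.Propositional using (_↭_)
open import Data.Maybe using (Maybe; just; nothing)
open import Relation.Binary.PropositionalEquality using (_≡_)

infixr 6 _⋀_
infixr 5 _⋁_
infixr 4 _⟶_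

data Fm : Set where
  var  : ℕ → Fm
  ⊥'   : Fm
  ⊤'   : Fm
  ¬'_  : Fm → Fm
  _⋀_  : Fm → Fm → Fm
  _⋁_  : Fm → Fm → Fm
  _⟶_  : Fm → Fm → Fm
  □_   : Fm → Fm

-- Propositional tautologies (substitution instances): formulas true
-- under every Boolean valuation that treats atoms and boxed formulas
-- as independent propositional letters.

imp : Bool → Bool → Bool
imp a b = not a ∨ b

eval : (ℕ → Bool) → (Fm → Bool) → Fm → Bool
eval v w (var p) = v p
eval v w ⊥' = false
eval v w ⊤' = true
eval v w (¬' A) = not (eval v w A)
eval v w (A ⋀ B) = eval v w A ∧ eval v w B
eval v w (A ⋁ B) = eval v w A ∨ eval v w B
eval v w (A ⟶ B) = imp (eval v w A) (eval v w B)
eval v w (□ A) = w A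

Tautology : Fm → Set
Tautology A = (v : ℕ → Bool) (w : Fm → Bool) → eval v w A ≡ true

data Ax : Set where
  C N P D T 4ax : Ax

AxSet : Set
AxSet = Ax → Bool

data Thm (𝒜 : AxSet) : Fm → Set where
  taut : ∀ {A} → Tautology A → Thm 𝒜 A
  axM  : ∀ {A B} → Thm 𝒜 (□ (A ⋀ B) ⟶ (□ A ⋀ □ B))
  axC  : ∀ {A B} → 𝒜 C ≡ true → Thm 𝒜 ((□ A ⋀ □ B) ⟶ □ (A ⋀ B))
  axN  : 𝒜 N ≡ true → Thm 𝒜 (□ ⊤')
  axP  : 𝒜 P ≡ true → Thm 𝒜 (¬' (□ ⊥'))
  axD  : ∀ {A} → 𝒜 D ≡ true → Thm 𝒜 (¬' (□ A ⋀ □ (¬' A)))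
  axT  : ∀ {A} → 𝒜 T ≡ true → Thm 𝒜 (□ A ⟶ A)
  ax4  : ∀ {A} → 𝒜 4ax ≡ true → Thm 𝒜 (□ A ⟶ □ (□ A))
  mp   : ∀ {A B} → Thm 𝒜 (A ⟶ B) → Thm 𝒜 A → Thm 𝒜 B
  re   : ∀ {A B} → Thm 𝒜 (A ⟶ B) → Thm 𝒜 (B ⟶ A) → Thm 𝒜 (□ A ⟶ □ B)

-- Multisets are represented by lists; the calculus contains an
-- exchange rule (permutation inside any component), so lists are
-- identified up to permutation, i.e. behave as multisets.

infix 3 _⇒_
data Seq : Set where
  _⇒_ : List Fm → List Fm → Seq

-- lin G S      is   G / S            (G a possibly empty prefix)
-- linm G S S'  is   G / S /ₘ S'
data Struct : Set where
  lin  : List Seq → Seq → Struct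
  linm : List Seq → Seq → Seq → Struct

-- build  pre / s / post₁ / ... / postₙ  [ /ₘ t ]
build : List Seq → Seq → List Seq → Maybe Seq → Struct
build pre s [] nothing = lin pre s
build pre s [] (just t) = linm pre s t
build pre s (x ∷ xs) m = build (pre ++ [ s ]) x xs m

-- Contexts S{ } whose hole is NOT the component after /ₘ
record Ctx : Set where
  constructor ctx
  field
    pre  : List Seq
    post : List Seq
    mtail : Maybe Seq

_⟪_⟫ : Ctx → Seq → Struct
ctx pre post m ⟪ s ⟫ = build pre s post m

data ACtx : Set where
  nonm : Ctx → ACtx
  atm  : List Seq → Seq → ACtx     -- G / S /ₘ [hole]

_⟦_⟧ : ACtx → Seq → Struct
nonm c ⟦ s ⟧ = c ⟪ s ⟫
atm G S ⟦ s ⟧ = linm G S s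

data LNS (𝒜 : AxSet) : Struct → Set where
  -- propositional rules (not on the /ₘ component)
  init : ∀ S Γ Δ p → LNS 𝒜 (S ⟪ var p ∷ Γ ⇒ var p ∷ Δ ⟫)
  ⊥L   : ∀ S Γ Δ → LNS 𝒜 (S ⟪ ⊥' ∷ Γ ⇒ Δ ⟫)
  ⊤R   : ∀ S Γ Δ → LNS 𝒜 (S ⟪ Γ ⇒ ⊤' ∷ Δ ⟫)
  ¬L   : ∀ S Γ Δ A → LNS 𝒜 (S ⟪ Γ ⇒ A ∷ Δ ⟫) → LNS 𝒜 (S ⟪ (¬' A) ∷ Γ ⇒ Δ ⟫)
  ¬R   : ∀ S Γ Δ A → LNS 𝒜 (S ⟪ A ∷ Γ ⇒ Δ ⟫) → LNS 𝒜 (S ⟪ Γ ⇒ (¬' A) ∷ Δ ⟫)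
  ∧L   : ∀ S Γ Δ A B → LNS 𝒜 (S ⟪ A ∷ B ∷ Γ ⇒ Δ ⟫) → LNS 𝒜 (S ⟪ (A ⋀ B) ∷ Γ ⇒ Δ ⟫)
  ∧R   : ∀ S Γ Δ A B → LNS 𝒜 (S ⟪ Γ ⇒ A ∷ Δ ⟫) → LNS 𝒜 (S ⟪ Γ ⇒ B ∷ Δ ⟫)
         → LNS 𝒜 (S ⟪ Γ ⇒ (A ⋀ B) ∷ Δ ⟫)
  ∨L   : ∀ S Γ Δ A B → LNS 𝒜 (S ⟪ A ∷ Γ ⇒ Δ ⟫) → LNS 𝒜 (S ⟪ B ∷ Γ ⇒ Δ ⟫)
         → LNS 𝒜 (S ⟪ (A ⋁ B) ∷ Γ ⇒ Δ ⟫)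
  ∨R   : ∀ S Γ Δ A B → LNS 𝒜 (S ⟪ Γ ⇒ A ∷ B ∷ Δ ⟫) → LNS 𝒜 (S ⟪ Γ ⇒ (A ⋁ B) ∷ Δ ⟫)
  →L   : ∀ S Γ Δ A B → LNS 𝒜 (S ⟪ Γ ⇒ A ∷ Δ ⟫) → LNS 𝒜 (S ⟪ B ∷ Γ ⇒ Δ ⟫)
         → LNS 𝒜 (S ⟪ (A ⟶ B) ∷ Γ ⇒ Δ ⟫)
  →R   : ∀ S Γ Δ A B → LNS 𝒜 (S ⟪ A ∷ Γ ⇒ B ∷ Δ ⟫) → LNS 𝒜 (S ⟪ Γ ⇒ (A ⟶ B) ∷ Δ ⟫)
  □Rm  : ∀ G Γ Δ B → LNS 𝒜 (linm G (Γ ⇒ Δ) ([] ⇒ [ B ]))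
         → LNS 𝒜 (lin G (Γ ⇒ (□ B) ∷ Δ))
  □Lm  : ∀ G Γ Δ Σ Π A → LNS 𝒜 (lin (G ++ [ Γ ⇒ Δ ]) (A ∷ Σ ⇒ Π))
         → LNS 𝒜 (linm G ((□ A) ∷ Γ ⇒ Δ) (Σ ⇒ Π))
  ruleC : ∀ G S Γ Δ → 𝒜 C ≡ true → LNS 𝒜 (linm G S (Γ ⇒ Δ))
          → LNS 𝒜 (lin (G ++ [ S ]) (Γ ⇒ Δ))
  ruleN : ∀ G S Γ Δ → 𝒜 N ≡ true → LNS 𝒜 (lin (G ++ [ S ]) (Γ ⇒ Δ))
          → LNS 𝒜 (linm G S (Γ ⇒ Δ))
  ruleP : ∀ G Γ Δ → 𝒜 P ≡ true → LNS 𝒜 (linm G (Γ ⇒ Δ) ([] ⇒ []))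
          → LNS 𝒜 (lin G (Γ ⇒ Δ))
  ruleD : ∀ G Γ Δ A → 𝒜 D ≡ true → LNS 𝒜 (linm G (Γ ⇒ Δ) ([ A ] ⇒ []))
          → LNS 𝒜 (lin G ((□ A) ∷ Γ ⇒ Δ))
  ruleT : ∀ G Γ Δ Σ Π → 𝒜 T ≡ true → LNS 𝒜 (linm G (Γ ⇒ Δ) (Σ ⇒ Π))
          → LNS 𝒜 (lin G (Γ ++ Σ ⇒ Δ ++ Π))
  rule4 : ∀ G Γ Δ Σ Π A → 𝒜 4ax ≡ true → LNS 𝒜 (lin (G ++ [ Γ ⇒ Δ ]) ((□ A) ∷ Σ ⇒ Π))
          → LNS 𝒜 (linm G ((□ A) ∷ Γ ⇒ Δ) (Σ ⇒ Π))
  wL   : ∀ S Γ Δ A → LNS 𝒜 (S ⟦ Γ ⇒ Δ ⟧) → LNS 𝒜 (S ⟦ A ∷ Γ ⇒ Δ ⟧)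
  wR   : ∀ S Γ Δ A → LNS 𝒜 (S ⟦ Γ ⇒ Δ ⟧) → LNS 𝒜 (S ⟦ Γ ⇒ A ∷ Δ ⟧)
  cL   : ∀ S Γ Δ A → LNS 𝒜 (S ⟦ A ∷ A ∷ Γ ⇒ Δ ⟧) → LNS 𝒜 (S ⟦ A ∷ Γ ⇒ Δ ⟧)
  cR   : ∀ S Γ Δ A → LNS 𝒜 (S ⟦ Γ ⇒ A ∷ A ∷ Δ ⟧) → LNS 𝒜 (S ⟦ Γ ⇒ A ∷ Δ ⟧)
  exch : ∀ S Γ Γ' Δ Δ' → Γ ↭ Γ' → Δ ↭ Δ' → LNS 𝒜 (S ⟦ Γ ⇒ Δ ⟧) → LNS 𝒜 (S ⟦ Γ' ⇒ Δ' ⟧)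

module Submission where

-- Soundness: a linear nested sequent is read as a formula, a component
-- Γ ⇒ Δ as ⋀Γ ⟶ ⋁Δ and, when axiom C is present, the components after it
-- as nested boxed disjuncts; every rule of LNS preserves the property that
-- the reading of some component is a theorem of M𝒜, and for ⇒ A that
-- reading is A.
--
-- Completeness: every theorem of M𝒜 is derivable in a G3-style sequent
-- calculus whose single modal rule combines the boxed formulas of the
-- antecedent into one premiss, with side conditions according to 𝒜:
-- tautologies by root-first proof search, modus ponens by admissibility of
-- cut.  Each rule of that calculus is simulated in LNS; the modal rule moves
-- its boxed formulas one by one into a new component by □L and 4, glued
-- together by C, and closes it by □R, N, P or D.

open import Data.Bool using (Bool; true; false; not; _∧_; _∨_; if_then_else_)
open import Data.Bool.Properties using (∧-assoc; ∨-assoc; ∨-zeroʳ; T-≡)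
open import Data.Empty using (⊥; ⊥-elim)
open import Data.List using (List; []; _∷_; _++_; [_]; map; length; fromMaybe)
open import Data.List.Properties using (length-map; ++-assoc; map-++; length-++; ++-identityʳ)
open import Data.List.Membership.Propositional using (_∈_; _∉_; find)
open import Data.List.Membership.Propositional.Properties using (∈-++⁺ˡ; ∈-++⁺ʳ; ∈-∃++)
open import Data.List.Relation.Binary.Permutation.Propositional as ↭ using (_↭_; ↭-sym; ↭-refl; ↭-reflexive)
open import Data.List.Relation.Binary.Permutation.Propositional.Properties using (shift; ∷↭∷ʳ)
open import Data.List.Relation.Binary.Subset.Propositional using (_⊆_)
open import Data.List.Relation.Binary.Subset.Propositional.Properties using
  (⊆-refl; ⊆-trans; ⊆-reflexive; ⊆-reflexive-↭; ∷⁺ʳ; ∈-∷⁺ʳ; ++⁺ʳ; Any-resp-⊆; All-resp-⊇)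
open import Data.List.Relation.Unary.All as All using (All; []; _∷_)
open import Data.List.Relation.Unary.All.Properties using (++⁺; ¬Any⇒All¬)
open import Data.List.Relation.Unary.Any using (Any; here; there; any?)
open import Data.Maybe using (Maybe; just; nothing)
open import Data.Nat as ℕ using (ℕ; zero; suc; _+_; _≤_; _⊔_; z≤n; s≤s)
open import Data.Nat.Properties using
  (m≤m⊔n; m≤n⊔m; ≤-refl; ≤-trans; ≤-reflexive; m≤n⇒m≤1+n; m≤m+n; m≤n+m; +-suc; +-assoc; +-identityʳ;
   m+n≡0⇒m≡0; +-mono-≤; +-monoˡ-≤; ≡ᵇ⇒≡; ≡⇒≡ᵇ)
open import Data.Nat.Tactic.RingSolver using (solve-∀)
open import Data.Product using (_×_; _,_; proj₁; proj₂; ∃)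
open import Data.Sum using (_⊎_; inj₁; inj₂)
open import Data.Unit using (⊤; tt)
open import Function using (_∘_; id; case_of_)
open import Function.Bundles using (Equivalence)
open import Relation.Binary.Definitions using (DecidableEquality)
open import Relation.Binary.PropositionalEquality using (_≡_; refl; sym; trans; cong; cong₂; subst; module ≡-Reasoning)
open import Relation.Nullary using (¬_; yes; no; does)
open import Relation.Nullary.Decidable using (dec-true; dec-false)

open import Defs

nthOr : {A : Set} → A → List A → ℕ → A
nthOr d [] _ = d
nthOr d (x ∷ xs) zero = x
nthOr d (x ∷ xs) (suc i) = nthOr d xs i

substFm : (ℕ → Fm) → Fm → Fm
substFm σ (var i) = σ i
substFm σ ⊥' = ⊥'
substFm σ ⊤' = ⊤'
substFm σ (¬' A) = ¬' substFm σ A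
substFm σ (A ⋀ B) = substFm σ A ⋀ substFm σ B
substFm σ (A ⋁ B) = substFm σ A ⋁ substFm σ B
substFm σ (A ⟶ B) = substFm σ A ⟶ substFm σ B
substFm σ (□ A) = □ substFm σ A

boxFree : Fm → Bool
boxFree (var i) = true
boxFree ⊥' = true
boxFree ⊤' = true
boxFree (¬' A) = boxFree A
boxFree (A ⋀ B) = boxFree A ∧ boxFree B
boxFree (A ⋁ B) = boxFree A ∧ boxFree B
boxFree (A ⟶ B) = boxFree A ∧ boxFree B
boxFree (□ A) = false

evalSchema : (ℕ → Bool) → Fm → Bool
evalSchema v = eval v (λ _ → false)

allValuations : ℕ → (List Bool → Bool) → Bool
allValuations zero φ = φ []
allValuations (suc n) φ = allValuations n (φ ∘ (true ∷_)) ∧ allValuations n (φ ∘ (false ∷_))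

-- Checked by evaluation: F has no boxes and is true whatever truth values
-- its first n variables get, the remaining ones being false.
validSchema : ℕ → Fm → Bool
validSchema n F = boxFree F ∧ allValuations n (λ bs → evalSchema (nthOr false bs) F)

∧-true⁻ : ∀ {a b} → (a ∧ b) ≡ true → a ≡ true × b ≡ true
∧-true⁻ {true} b≡true = refl , b≡true

eval-substFm : ∀ v w σ F → boxFree F ≡ true →
               eval v w (substFm σ F) ≡ evalSchema (λ i → eval v w (σ i)) F
eval-substFm v w σ (var i) _ = refl
eval-substFm v w σ ⊥' _ = refl
eval-substFm v w σ ⊤' _ = refl
eval-substFm v w σ (¬' A) h = cong not (eval-substFm v w σ A h)
eval-substFm v w σ (A ⋀ B) h =
  cong₂ _∧_ (eval-substFm v w σ A (proj₁ (∧-true⁻ h))) (eval-substFm v w σ B (proj₂ (∧-true⁻ h)))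
eval-substFm v w σ (A ⋁ B) h =
  cong₂ _∨_ (eval-substFm v w σ A (proj₁ (∧-true⁻ h))) (eval-substFm v w σ B (proj₂ (∧-true⁻ h)))
eval-substFm v w σ (A ⟶ B) h =
  cong₂ imp (eval-substFm v w σ A (proj₁ (∧-true⁻ h))) (eval-substFm v w σ B (proj₂ (∧-true⁻ h)))

evalSchema-cong : ∀ {u u'} → (∀ i → u i ≡ u' i) → ∀ F → evalSchema u F ≡ evalSchema u' F
evalSchema-cong u≗u' (var i) = u≗u' i
evalSchema-cong u≗u' ⊥' = refl
evalSchema-cong u≗u' ⊤' = refl
evalSchema-cong u≗u' (¬' A) = cong not (evalSchema-cong u≗u' A)
evalSchema-cong u≗u' (A ⋀ B) = cong₂ _∧_ (evalSchema-cong u≗u' A) (evalSchema-cong u≗u' B)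
evalSchema-cong u≗u' (A ⋁ B) = cong₂ _∨_ (evalSchema-cong u≗u' A) (evalSchema-cong u≗u' B)
evalSchema-cong u≗u' (A ⟶ B) = cong₂ imp (evalSchema-cong u≗u' A) (evalSchema-cong u≗u' B)
evalSchema-cong u≗u' (□ A) = refl

eval-nthOr : ∀ v w xs i → eval v w (nthOr ⊥' xs i) ≡ nthOr false (map (eval v w) xs) i
eval-nthOr v w [] i = refl
eval-nthOr v w (x ∷ xs) zero = refl
eval-nthOr v w (x ∷ xs) (suc i) = eval-nthOr v w xs i

allValuations-sound : ∀ n φ → allValuations n φ ≡ true → ∀ bs → length bs ≡ n → φ bs ≡ true
allValuations-sound zero φ h [] refl = h
allValuations-sound (suc n) φ h (true ∷ bs) refl = allValuations-sound n _ (proj₁ (∧-true⁻ h)) bs refl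
allValuations-sound (suc n) φ h (false ∷ bs) refl = allValuations-sound n _ (proj₂ (∧-true⁻ h)) bs refl

validSchema⇒tautology : ∀ F xs → validSchema (length xs) F ≡ true → Tautology (substFm (nthOr ⊥' xs) F)
validSchema⇒tautology F xs h v w = begin
  eval v w (substFm (nthOr ⊥' xs) F)                ≡⟨ eval-substFm v w _ F (proj₁ (∧-true⁻ h)) ⟩
  evalSchema (λ i → eval v w (nthOr ⊥' xs i)) F    ≡⟨ evalSchema-cong (eval-nthOr v w xs) F ⟩
  evalSchema (nthOr false (map (eval v w) xs)) F
    ≡⟨ allValuations-sound (length xs) _ (proj₂ (∧-true⁻ h)) (map (eval v w) xs) (length-map _ xs) ⟩
  true                                             ∎
  where open ≡-Reasoning

module Hilbert (𝒜 : AxSet) where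

  infix 2 ⊢_
  ⊢_ : Fm → Set
  ⊢_ = Thm 𝒜

  -- Propositional reasoning: pₖ in F stands for the k-th formula of xs.
  schema : ∀ F xs → validSchema (length xs) F ≡ true → ⊢ substFm (nthOr ⊥' xs) F
  schema F xs h = taut (validSchema⇒tautology F xs h)

  p₀ p₁ p₂ p₃ p₄ : Fm
  p₀ = var 0
  p₁ = var 1
  p₂ = var 2
  p₃ = var 3
  p₄ = var 4

  mp₂ : ∀ {A B X} → ⊢ A ⟶ B ⟶ X → ⊢ A → ⊢ B → ⊢ X
  mp₂ h a b = mp (mp h a) b

  ⟶-trans : ∀ {A B X} → ⊢ A ⟶ B → ⊢ B ⟶ X → ⊢ A ⟶ X
  ⟶-trans {A} {B} {X} = mp₂ (schema ((p₀ ⟶ p₁) ⟶ (p₁ ⟶ p₂) ⟶ (p₀ ⟶ p₂)) (A ∷ B ∷ X ∷ []) refl)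

  ⟶-refl : ∀ {A} → ⊢ A ⟶ A
  ⟶-refl {A} = schema (p₀ ⟶ p₀) (A ∷ []) refl

  -- Rule RE applied to A ↔ A ⋀ B, then axiom M.
  □-mono : ∀ {A B} → ⊢ A ⟶ B → ⊢ □ A ⟶ □ B
  □-mono {A} {B} A⟶B = ⟶-trans (re A⟶A⋀B A⋀B⟶A) (⟶-trans axM (schema (p₀ ⋀ p₁ ⟶ p₁) (□ A ∷ □ B ∷ []) refl))
    where
    A⟶A⋀B : ⊢ A ⟶ A ⋀ B
    A⟶A⋀B = mp (schema ((p₀ ⟶ p₁) ⟶ (p₀ ⟶ p₀ ⋀ p₁)) (A ∷ B ∷ []) refl) A⟶B
    A⋀B⟶A : ⊢ A ⋀ B ⟶ A
    A⋀B⟶A = schema (p₀ ⋀ p₁ ⟶ p₀) (A ∷ B ∷ []) refl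

  □-nec : 𝒜 N ≡ true → ∀ {A} → ⊢ A → ⊢ □ A
  □-nec n {A} ⊢A = mp (re ⊤⟶A (schema (p₀ ⟶ ⊤') (A ∷ []) refl)) (axN n)
    where
    ⊤⟶A : ⊢ ⊤' ⟶ A
    ⊤⟶A = mp (schema (p₀ ⟶ p₁ ⟶ p₀) (A ∷ ⊤' ∷ []) refl) ⊢A

  entailment⇒⊢ : ∀ {A B} → (∀ v w → eval v w A ≡ true → eval v w B ≡ true) → ⊢ A ⟶ B
  entailment⇒⊢ {A} {B} A⊨B = taut λ v w → imp-intro (eval v w A) (eval v w B) (A⊨B v w)
    where
    imp-intro : ∀ a b → (a ≡ true → b ≡ true) → imp a b ≡ true
    imp-intro false b f = refl
    imp-intro true b f = f refl

⋀* : List Fm → Fm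
⋀* [] = ⊤'
⋀* (A ∷ Γ) = A ⋀ ⋀* Γ

⋁* : List Fm → Fm
⋁* [] = ⊥'
⋁* (A ∷ Δ) = A ⋁ ⋁* Δ

seqFm : Seq → Fm
seqFm (Γ ⇒ Δ) = ⋀* Γ ⟶ ⋁* Δ

-- With c = true the components after a given one are read as nested boxed
-- disjuncts, as in the formula interpretation of linear nested sequents;
-- with c = false (no axiom C available) they are dropped.
nestFm : Bool → List Seq → Maybe Seq → Fm
nestFm c [] nothing = ⊥'
nestFm c [] (just t) = □ seqFm t
nestFm true (s ∷ post) m = □ (seqFm s ⋁ nestFm true post m)
nestFm false (s ∷ post) m = ⊥'

componentFm : Bool → Seq → List Seq → Maybe Seq → Fm
componentFm c s post m = seqFm s ⋁ nestFm c post m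

nestFm-false : ∀ pre s post m → nestFm false (pre ++ s ∷ post) m ≡ ⊥'
nestFm-false [] s post m = refl
nestFm-false (x ∷ pre) s post m = refl

eval-⋀*-++ : ∀ v w Γ Σ → eval v w (⋀* (Γ ++ Σ)) ≡ (eval v w (⋀* Γ) ∧ eval v w (⋀* Σ))
eval-⋀*-++ v w [] Σ = refl
eval-⋀*-++ v w (A ∷ Γ) Σ = trans (cong (eval v w A ∧_) (eval-⋀*-++ v w Γ Σ)) (sym (∧-assoc (eval v w A) _ _))

eval-⋁*-++ : ∀ v w Δ Π → eval v w (⋁* (Δ ++ Π)) ≡ (eval v w (⋁* Δ) ∨ eval v w (⋁* Π))
eval-⋁*-++ v w [] Π = refl
eval-⋁*-++ v w (A ∷ Δ) Π = trans (cong (eval v w A ∨_) (eval-⋁*-++ v w Δ Π)) (sym (∨-assoc (eval v w A) _ _))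

∧-leftComm : ∀ x y z → (x ∧ (y ∧ z)) ≡ (y ∧ (x ∧ z))
∧-leftComm true y z = refl
∧-leftComm false true z = refl
∧-leftComm false false z = refl

∨-leftComm : ∀ x y z → (x ∨ (y ∨ z)) ≡ (y ∨ (x ∨ z))
∨-leftComm true true z = refl
∨-leftComm true false z = refl
∨-leftComm false y z = refl

eval-⋀*-↭ : ∀ v w {Γ Γ'} → Γ ↭ Γ' → eval v w (⋀* Γ) ≡ eval v w (⋀* Γ')
eval-⋀*-↭ v w ↭.refl = refl
eval-⋀*-↭ v w (↭.prep A p) = cong (eval v w A ∧_) (eval-⋀*-↭ v w p)
eval-⋀*-↭ v w (↭.swap A B p) =
  trans (cong (λ z → eval v w A ∧ (eval v w B ∧ z)) (eval-⋀*-↭ v w p)) (∧-leftComm (eval v w A) (eval v w B) _)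
eval-⋀*-↭ v w (↭.trans p q) = trans (eval-⋀*-↭ v w p) (eval-⋀*-↭ v w q)

eval-⋁*-↭ : ∀ v w {Δ Δ'} → Δ ↭ Δ' → eval v w (⋁* Δ) ≡ eval v w (⋁* Δ')
eval-⋁*-↭ v w ↭.refl = refl
eval-⋁*-↭ v w (↭.prep A p) = cong (eval v w A ∨_) (eval-⋁*-↭ v w p)
eval-⋁*-↭ v w (↭.swap A B p) =
  trans (cong (λ z → eval v w A ∨ (eval v w B ∨ z)) (eval-⋁*-↭ v w p)) (∨-leftComm (eval v w A) (eval v w B) _)
eval-⋁*-↭ v w (↭.trans p q) = trans (eval-⋁*-↭ v w p) (eval-⋁*-↭ v w q)

module Soundness (𝒜 : AxSet) where
  open Hilbert 𝒜

  ValidFrom : Bool → List Seq → Maybe Seq → Set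
  ValidFrom c [] m = ⊥
  ValidFrom c (s ∷ post) m = (⊢ componentFm c s post m) ⊎ ValidFrom c post m

  Valid : Bool → Struct → Set
  Valid c (lin G s) = ValidFrom c (G ++ [ s ]) nothing
  Valid c (linm G s t) = ValidFrom c (G ++ [ s ]) (just t)

  NestingAllowed : Bool → Set
  NestingAllowed c = c ≡ true → 𝒜 C ≡ true

  Valid-build : ∀ c pre s post m → Valid c (build pre s post m) ≡ ValidFrom c (pre ++ s ∷ post) m
  Valid-build c pre s [] nothing = refl
  Valid-build c pre s [] (just t) = refl
  Valid-build c pre s (x ∷ post) m =
    trans (Valid-build c (pre ++ [ s ]) x post m) (cong (λ L → ValidFrom c L m) (++-assoc pre [ s ] (x ∷ post)))

  ValidFrom-assoc : ∀ c G s t m → ValidFrom c ((G ++ [ s ]) ++ [ t ]) m ≡ ValidFrom c (G ++ s ∷ [ t ]) m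
  ValidFrom-assoc c G s t m = cong (λ L → ValidFrom c L m) (++-assoc G [ s ] [ t ])

  ⋁-monoˡ : ∀ {A B X} → ⊢ A ⟶ B → ⊢ A ⋁ X ⟶ B ⋁ X
  ⋁-monoˡ {A} {B} {X} = mp (schema ((p₀ ⟶ p₁) ⟶ (p₀ ⋁ p₂ ⟶ p₁ ⋁ p₂)) (A ∷ B ∷ X ∷ []) refl)

  ⋁-monoʳ : ∀ {A X Y} → ⊢ X ⟶ Y → ⊢ A ⋁ X ⟶ A ⋁ Y
  ⋁-monoʳ {A} {X} {Y} = mp (schema ((p₁ ⟶ p₂) ⟶ (p₀ ⋁ p₁ ⟶ p₀ ⋁ p₂)) (A ∷ X ∷ Y ∷ []) refl)

  ⋀-comm-antecedent : ∀ {A B X} → ⊢ A ⋀ B ⟶ X → ⊢ B ⋀ A ⟶ X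
  ⋀-comm-antecedent {A} {B} {X} = mp (schema ((p₀ ⋀ p₁ ⟶ p₂) ⟶ (p₁ ⋀ p₀ ⟶ p₂)) (A ∷ B ∷ X ∷ []) refl)

  ValidFrom-axiom : ∀ c pre s post m → ⊢ seqFm s → ValidFrom c (pre ++ s ∷ post) m
  ValidFrom-axiom c [] s post m ⊢s =
    inj₁ (mp (schema (p₀ ⟶ p₀ ⋁ p₁) (seqFm s ∷ nestFm c post m ∷ []) refl) ⊢s)
  ValidFrom-axiom c (x ∷ pre) s post m ⊢s = inj₂ (ValidFrom-axiom c pre s post m ⊢s)

  nestFm-suffix : ∀ c G s ss m s' ss' m' → (c ≡ true → ⊢ componentFm c s ss m ⟶ componentFm c s' ss' m') →
                  ⊢ nestFm c (G ++ s ∷ ss) m ⟶ nestFm c (G ++ s' ∷ ss') m'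
  nestFm-suffix false G s ss m s' ss' m' _ rewrite nestFm-false G s ss m | nestFm-false G s' ss' m' = ⟶-refl
  nestFm-suffix true [] s ss m s' ss' m' h = □-mono (h refl)
  nestFm-suffix true (x ∷ G) s ss m s' ss' m' h = □-mono (⋁-monoʳ (nestFm-suffix true G s ss m s' ss' m' h))

  ValidFrom-suffix : ∀ c G s ss m s' ss' m' → (ValidFrom c (s ∷ ss) m → ValidFrom c (s' ∷ ss') m') →
                     (c ≡ true → ⊢ componentFm c s ss m ⟶ componentFm c s' ss' m') →
                     ValidFrom c (G ++ s ∷ ss) m → ValidFrom c (G ++ s' ∷ ss') m'
  ValidFrom-suffix c [] s ss m s' ss' m' f h v = f v
  ValidFrom-suffix c (x ∷ G) s ss m s' ss' m' f h (inj₁ a) =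
    inj₁ (mp (⋁-monoʳ (nestFm-suffix c G s ss m s' ss' m' h)) a)
  ValidFrom-suffix c (x ∷ G) s ss m s' ss' m' f h (inj₂ v) = inj₂ (ValidFrom-suffix c G s ss m s' ss' m' f h v)

  ValidFrom-last : ∀ c G s m s' m' → (∀ c → ⊢ componentFm c s [] m ⟶ componentFm c s' [] m') →
                   ValidFrom c (G ++ [ s ]) m → ValidFrom c (G ++ [ s' ]) m'
  ValidFrom-last c G s m s' m' h = ValidFrom-suffix c G s [] m s' [] m' last (λ _ → h c)
    where
    last : ValidFrom c [ s ] m → ValidFrom c [ s' ] m'
    last (inj₁ a) = inj₁ (mp (h c) a)

  ValidFrom-mono : ∀ c pre s s' post m → ⊢ seqFm s ⟶ seqFm s' →
                   ValidFrom c (pre ++ s ∷ post) m → ValidFrom c (pre ++ s' ∷ post) m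
  ValidFrom-mono c pre s s' post m s⟶s' = ValidFrom-suffix c pre s post m s' post m atHead (λ _ → ⋁-monoˡ s⟶s')
    where
    atHead : ValidFrom c (s ∷ post) m → ValidFrom c (s' ∷ post) m
    atHead (inj₁ a) = inj₁ (mp (⋁-monoˡ s⟶s') a)
    atHead (inj₂ v) = inj₂ v

  nestFm-merge : 𝒜 C ≡ true → ∀ pre s₁ s₂ s post m → ⊢ seqFm s₁ ⋀ seqFm s₂ ⟶ seqFm s →
                 ⊢ nestFm true (pre ++ s₁ ∷ post) m ⋀ nestFm true (pre ++ s₂ ∷ post) m ⟶ nestFm true (pre ++ s ∷ post) m
  nestFm-merge c∈𝒜 [] s₁ s₂ s post m h = ⟶-trans (axC c∈𝒜) (□-mono (mp
    (schema (((p₀ ⋀ p₁) ⟶ p₂) ⟶ ((p₀ ⋁ p₃) ⋀ (p₁ ⋁ p₃) ⟶ p₂ ⋁ p₃))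
            (seqFm s₁ ∷ seqFm s₂ ∷ seqFm s ∷ nestFm true post m ∷ []) refl) h))
  nestFm-merge c∈𝒜 (x ∷ pre) s₁ s₂ s post m h = ⟶-trans (axC c∈𝒜) (□-mono (mp
    (schema (((p₁ ⋀ p₂) ⟶ p₃) ⟶ ((p₀ ⋁ p₁) ⋀ (p₀ ⋁ p₂) ⟶ p₀ ⋁ p₃)) (seqFm x ∷ _ ∷ _ ∷ _ ∷ []) refl)
    (nestFm-merge c∈𝒜 pre s₁ s₂ s post m h)))

  -- If the second premiss is valid only inside the nesting of an earlier
  -- component, axiom C merges it into that nesting.
  ValidFrom-absorb : 𝒜 C ≡ true → ∀ pre s₁ s₂ s post m → ⊢ seqFm s₁ ⋀ seqFm s₂ ⟶ seqFm s →
                     ValidFrom true (pre ++ s₂ ∷ post) m →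
                     ValidFrom true (pre ++ s ∷ post) m ⊎
                     (⊢ nestFm true (pre ++ s₁ ∷ post) m ⟶ nestFm true (pre ++ s ∷ post) m)
  ValidFrom-absorb c∈𝒜 [] s₁ s₂ s post m h (inj₁ a) = inj₂ (□-mono (mp₂
    (schema (((p₀ ⋀ p₁) ⟶ p₂) ⟶ (p₁ ⋁ p₃) ⟶ (p₀ ⋁ p₃ ⟶ p₂ ⋁ p₃))
            (seqFm s₁ ∷ seqFm s₂ ∷ seqFm s ∷ nestFm true post m ∷ []) refl) h a))
  ValidFrom-absorb c∈𝒜 [] s₁ s₂ s post m h (inj₂ v) = inj₁ (inj₂ v)
  ValidFrom-absorb c∈𝒜 (x ∷ pre) s₁ s₂ s post m h (inj₁ a) = inj₂ (□-mono (mp₂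
    (schema (((p₁ ⋀ p₂) ⟶ p₃) ⟶ (p₀ ⋁ p₂) ⟶ (p₀ ⋁ p₁ ⟶ p₀ ⋁ p₃)) (seqFm x ∷ _ ∷ _ ∷ _ ∷ []) refl)
    (nestFm-merge c∈𝒜 pre s₁ s₂ s post m h) a))
  ValidFrom-absorb c∈𝒜 (x ∷ pre) s₁ s₂ s post m h (inj₂ v) with ValidFrom-absorb c∈𝒜 pre s₁ s₂ s post m h v
  ... | inj₁ u = inj₁ (inj₂ u)
  ... | inj₂ i = inj₂ (□-mono (⋁-monoʳ i))

  ValidFrom-merge : ∀ c → NestingAllowed c → ∀ pre s₁ s₂ s post m → ⊢ seqFm s₁ ⋀ seqFm s₂ ⟶ seqFm s →
                    ValidFrom c (pre ++ s₁ ∷ post) m → ValidFrom c (pre ++ s₂ ∷ post) m →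
                    ValidFrom c (pre ++ s ∷ post) m
  ValidFrom-merge c _ [] s₁ s₂ s post m h (inj₁ a) (inj₁ b) = inj₁ (mp₂ (mp
    (schema (((p₀ ⋀ p₁) ⟶ p₂) ⟶ (p₀ ⋁ p₃) ⟶ (p₁ ⋁ p₃) ⟶ (p₂ ⋁ p₃))
            (seqFm s₁ ∷ seqFm s₂ ∷ seqFm s ∷ nestFm c post m ∷ []) refl) h) a b)
  ValidFrom-merge c _ [] s₁ s₂ s post m h (inj₁ a) (inj₂ b) = inj₂ b
  ValidFrom-merge c _ [] s₁ s₂ s post m h (inj₂ a) _ = inj₂ a
  ValidFrom-merge c ok (x ∷ pre) s₁ s₂ s post m h (inj₂ a) (inj₂ b) =
    inj₂ (ValidFrom-merge c ok pre s₁ s₂ s post m h a b)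
  ValidFrom-merge false _ (x ∷ pre) s₁ s₂ s post m h (inj₁ a) _ =
    inj₁ (subst (λ X → ⊢ seqFm x ⋁ X) (trans (nestFm-false pre s₁ post m) (sym (nestFm-false pre s post m))) a)
  ValidFrom-merge false _ (x ∷ pre) s₁ s₂ s post m h (inj₂ a) (inj₁ b) =
    inj₁ (subst (λ X → ⊢ seqFm x ⋁ X) (trans (nestFm-false pre s₂ post m) (sym (nestFm-false pre s post m))) b)
  ValidFrom-merge true ok (x ∷ pre) s₁ s₂ s post m h (inj₁ a) (inj₁ b) = inj₁ (mp₂ (mp
    (schema (((p₁ ⋀ p₂) ⟶ p₃) ⟶ (p₀ ⋁ p₁) ⟶ (p₀ ⋁ p₂) ⟶ (p₀ ⋁ p₃)) (seqFm x ∷ _ ∷ _ ∷ _ ∷ []) refl)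
    (nestFm-merge (ok refl) pre s₁ s₂ s post m h)) a b)
  ValidFrom-merge true ok (x ∷ pre) s₁ s₂ s post m h (inj₁ a) (inj₂ b)
    with ValidFrom-absorb (ok refl) pre s₁ s₂ s post m h b
  ... | inj₁ u = inj₂ u
  ... | inj₂ i = inj₁ (mp (⋁-monoʳ i) a)
  ValidFrom-merge true ok (x ∷ pre) s₁ s₂ s post m h (inj₂ a) (inj₁ b)
    with ValidFrom-absorb (ok refl) pre s₂ s₁ s post m (⋀-comm-antecedent h) a
  ... | inj₁ u = inj₂ u
  ... | inj₂ i = inj₁ (mp (⋁-monoʳ i) b)

  plug-axiom : ∀ c S s → ⊢ seqFm s → Valid c (S ⟪ s ⟫)
  plug-axiom c (ctx pre post m) s ⊢s =
    subst id (sym (Valid-build c pre s post m)) (ValidFrom-axiom c pre s post m ⊢s)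

  plug-mono : ∀ c S s s' → ⊢ seqFm s ⟶ seqFm s' → Valid c (S ⟪ s ⟫) → Valid c (S ⟪ s' ⟫)
  plug-mono c (ctx pre post m) s s' h v = subst id (sym (Valid-build c pre s' post m))
    (ValidFrom-mono c pre s s' post m h (subst id (Valid-build c pre s post m) v))

  plug-merge : ∀ c → NestingAllowed c → ∀ S s₁ s₂ s → ⊢ seqFm s₁ ⋀ seqFm s₂ ⟶ seqFm s →
               Valid c (S ⟪ s₁ ⟫) → Valid c (S ⟪ s₂ ⟫) → Valid c (S ⟪ s ⟫)
  plug-merge c ok (ctx pre post m) s₁ s₂ s h v₁ v₂ = subst id (sym (Valid-build c pre s post m))
    (ValidFrom-merge c ok pre s₁ s₂ s post m h
      (subst id (Valid-build c pre s₁ post m) v₁) (subst id (Valid-build c pre s₂ post m) v₂))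

  anyplug-mono : ∀ c S s s' → ⊢ seqFm s ⟶ seqFm s' → Valid c (S ⟦ s ⟧) → Valid c (S ⟦ s' ⟧)
  anyplug-mono c (nonm S) s s' h = plug-mono c S s s' h
  anyplug-mono c (atm G s₀) s s' h = ValidFrom-last c G s₀ (just s) s₀ (just s') (λ _ → ⋁-monoʳ (□-mono h))

  component-□R : ∀ Γ Δ B c →
                 ⊢ componentFm c (Γ ⇒ Δ) [] (just ([] ⇒ [ B ])) ⟶ componentFm c (Γ ⇒ □ B ∷ Δ) [] nothing
  component-□R Γ Δ B c =
    mp (schema ((p₂ ⟶ p₃) ⟶ ((p₀ ⟶ p₁) ⋁ p₂) ⟶ ((p₀ ⟶ p₃ ⋁ p₁) ⋁ ⊥'))
               (⋀* Γ ∷ ⋁* Δ ∷ □ (⊤' ⟶ B ⋁ ⊥') ∷ □ B ∷ []) refl)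
       (□-mono (schema ((⊤' ⟶ p₀ ⋁ ⊥') ⟶ p₀) (B ∷ []) refl))

  -- Rules □L and 4 at once: X is A itself, or □ A using axiom 4.
  component-□L : 𝒜 C ≡ true → ∀ Γ Δ Σ Π A X → ⊢ □ A ⟶ □ X →
                 ⊢ componentFm true (Γ ⇒ Δ) [ X ∷ Σ ⇒ Π ] nothing ⟶
                   componentFm true (□ A ∷ Γ ⇒ Δ) [] (just (Σ ⇒ Π))
  component-□L c∈𝒜 Γ Δ Σ Π A X □A⟶□X =
    mp (schema ((p₂ ⋀ p₃ ⟶ p₄) ⟶ ((p₀ ⟶ p₁) ⋁ p₃) ⟶ ((p₂ ⋀ p₀ ⟶ p₁) ⋁ p₄))
               (⋀* Γ ∷ ⋁* Δ ∷ □ A ∷ □ Y ∷ □ Z ∷ []) refl) merged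
    where
    Y = (X ⋀ ⋀* Σ ⟶ ⋁* Π) ⋁ ⊥'
    Z = ⋀* Σ ⟶ ⋁* Π
    merged : ⊢ □ A ⋀ □ Y ⟶ □ Z
    merged = ⟶-trans (mp (schema ((p₀ ⟶ p₁) ⟶ (p₀ ⋀ p₂ ⟶ p₁ ⋀ p₂)) (□ A ∷ □ X ∷ □ Y ∷ []) refl) □A⟶□X)
      (⟶-trans (axC c∈𝒜) (□-mono (schema (p₀ ⋀ ((p₀ ⋀ p₁ ⟶ p₂) ⋁ ⊥') ⟶ (p₁ ⟶ p₂)) (X ∷ ⋀* Σ ∷ ⋁* Π ∷ []) refl)))

  ValidFrom-□L : ∀ c → NestingAllowed c → ∀ Γ Δ Σ Π A X → ⊢ □ A ⟶ □ X →
                 ValidFrom c ((Γ ⇒ Δ) ∷ [ X ∷ Σ ⇒ Π ]) nothing → ValidFrom c [ □ A ∷ Γ ⇒ Δ ] (just (Σ ⇒ Π))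
  ValidFrom-□L true ok Γ Δ Σ Π A X h (inj₁ a) = inj₁ (mp (component-□L (ok refl) Γ Δ Σ Π A X h) a)
  ValidFrom-□L false ok Γ Δ Σ Π A X h (inj₁ a) = inj₁ (mp
    (schema (((p₀ ⟶ p₁) ⋁ ⊥') ⟶ ((p₂ ⋀ p₀ ⟶ p₁) ⋁ p₃)) (⋀* Γ ∷ ⋁* Δ ∷ □ A ∷ □ (⋀* Σ ⟶ ⋁* Π) ∷ []) refl) a)
  ValidFrom-□L c ok Γ Δ Σ Π A X h (inj₂ (inj₁ b)) = inj₁ (mp
    (schema ((p₂ ⟶ p₃) ⟶ ((p₂ ⋀ p₀ ⟶ p₁) ⋁ p₃)) (⋀* Γ ∷ ⋁* Δ ∷ □ A ∷ □ (⋀* Σ ⟶ ⋁* Π) ∷ []) refl)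
    (⟶-trans h (□-mono X⟶seq)))
    where
    X⟶seq : ⊢ X ⟶ (⋀* Σ ⟶ ⋁* Π)
    X⟶seq = mp (schema (((p₀ ⋀ p₁ ⟶ p₂) ⋁ ⊥') ⟶ (p₀ ⟶ (p₁ ⟶ p₂))) (X ∷ ⋀* Σ ∷ ⋁* Π ∷ []) refl) b

  Valid-□L : ∀ c → NestingAllowed c → ∀ G Γ Δ Σ Π A X → ⊢ □ A ⟶ □ X →
             Valid c (lin (G ++ [ Γ ⇒ Δ ]) (X ∷ Σ ⇒ Π)) → Valid c (linm G (□ A ∷ Γ ⇒ Δ) (Σ ⇒ Π))
  Valid-□L c ok G Γ Δ Σ Π A X h v =
    ValidFrom-suffix c G _ _ _ _ _ _ (ValidFrom-□L c ok Γ Δ Σ Π A X h) nested (subst id (ValidFrom-assoc c G _ _ _) v)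
    where
    nested : c ≡ true → ⊢ componentFm c (Γ ⇒ Δ) [ X ∷ Σ ⇒ Π ] nothing ⟶
                          componentFm c (□ A ∷ Γ ⇒ Δ) [] (just (Σ ⇒ Π))
    nested refl = component-□L (ok refl) Γ Δ Σ Π A X h

  Valid-C : ∀ c → c ≡ true → ∀ G s t → Valid c (linm G s t) → Valid c (lin (G ++ [ s ]) t)
  Valid-C true refl G s t v = subst id (sym (ValidFrom-assoc true G s t nothing))
    (ValidFrom-suffix true G s [] (just t) s [ t ] nothing last (λ _ → unnest) v)
    where
    unnest : ⊢ componentFm true s [] (just t) ⟶ componentFm true s [ t ] nothing
    unnest = ⋁-monoʳ (□-mono (schema (p₀ ⟶ p₀ ⋁ ⊥') (seqFm t ∷ []) refl))
    last : ValidFrom true [ s ] (just t) → ValidFrom true (s ∷ [ t ]) nothing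
    last (inj₁ a) = inj₁ (mp unnest a)

  component-N : ∀ s t → ⊢ componentFm true s [ t ] nothing ⟶ componentFm true s [] (just t)
  component-N s t = ⋁-monoʳ (□-mono (schema (p₀ ⋁ ⊥' ⟶ p₀) (seqFm t ∷ []) refl))

  ValidFrom-N : ∀ c → 𝒜 N ≡ true → ∀ s t → ValidFrom c (s ∷ [ t ]) nothing → ValidFrom c [ s ] (just t)
  ValidFrom-N c n∈𝒜 s t (inj₂ (inj₁ b)) = inj₁ (mp (schema (p₁ ⟶ p₀ ⋁ p₁) (seqFm s ∷ □ seqFm t ∷ []) refl)
    (□-nec n∈𝒜 (mp (schema (p₀ ⋁ ⊥' ⟶ p₀) (seqFm t ∷ []) refl) b)))
  ValidFrom-N true n∈𝒜 s t (inj₁ a) = inj₁ (mp (component-N s t) a)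
  ValidFrom-N false n∈𝒜 s t (inj₁ a) = inj₁ (mp (schema (p₀ ⋁ ⊥' ⟶ p₀ ⋁ p₁) (seqFm s ∷ □ seqFm t ∷ []) refl) a)

  Valid-N : ∀ c → 𝒜 N ≡ true → ∀ G s t → Valid c (lin (G ++ [ s ]) t) → Valid c (linm G s t)
  Valid-N c n∈𝒜 G s t v = ValidFrom-suffix c G s [ t ] nothing s [] (just t) (ValidFrom-N c n∈𝒜 s t) nested
    (subst id (ValidFrom-assoc c G s t nothing) v)
    where
    nested : c ≡ true → ⊢ componentFm c s [ t ] nothing ⟶ componentFm c s [] (just t)
    nested refl = component-N s t

  component-P : 𝒜 P ≡ true → ∀ Γ Δ c →
                ⊢ componentFm c (Γ ⇒ Δ) [] (just ([] ⇒ [])) ⟶ componentFm c (Γ ⇒ Δ) [] nothing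
  component-P p∈𝒜 Γ Δ c =
    mp₂ (schema ((p₁ ⟶ p₂) ⟶ ¬' p₂ ⟶ (p₀ ⋁ p₁ ⟶ p₀ ⋁ ⊥')) (seqFm (Γ ⇒ Δ) ∷ □ (⊤' ⟶ ⊥') ∷ □ ⊥' ∷ []) refl)
        (□-mono (schema ((⊤' ⟶ ⊥') ⟶ ⊥') [] refl)) (axP p∈𝒜)

  component-D : 𝒜 D ≡ true → ∀ Γ Δ A c →
                ⊢ componentFm c (Γ ⇒ Δ) [] (just ([ A ] ⇒ [])) ⟶ componentFm c (□ A ∷ Γ ⇒ Δ) [] nothing
  component-D d∈𝒜 Γ Δ A c =
    mp₂ (schema ((p₂ ⟶ p₃) ⟶ ¬' (p₄ ⋀ p₃) ⟶ ((p₀ ⟶ p₁) ⋁ p₂) ⟶ ((p₄ ⋀ p₀ ⟶ p₁) ⋁ ⊥'))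
                (⋀* Γ ∷ ⋁* Δ ∷ □ (A ⋀ ⊤' ⟶ ⊥') ∷ □ (¬' A) ∷ □ A ∷ []) refl)
        (□-mono (schema ((p₀ ⋀ ⊤' ⟶ ⊥') ⟶ ¬' p₀) (A ∷ []) refl)) (axD d∈𝒜)

  component-T : 𝒜 T ≡ true → ∀ Γ Δ Σ Π c →
                ⊢ componentFm c (Γ ⇒ Δ) [] (just (Σ ⇒ Π)) ⟶ componentFm c (Γ ++ Σ ⇒ Δ ++ Π) [] nothing
  component-T t∈𝒜 Γ Δ Σ Π c = ⟶-trans
    (mp (schema ((p₄ ⟶ (p₂ ⟶ p₃)) ⟶ ((p₀ ⟶ p₁) ⋁ p₄) ⟶ ((p₀ ⋀ p₂ ⟶ p₁ ⋁ p₃) ⋁ ⊥'))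
                (⋀* Γ ∷ ⋁* Δ ∷ ⋀* Σ ∷ ⋁* Π ∷ □ (⋀* Σ ⟶ ⋁* Π) ∷ []) refl) (axT t∈𝒜))
    (entailment⇒⊢ λ v w → subst (λ b → (b ∨ false) ≡ true)
                                (sym (cong₂ imp (eval-⋀*-++ v w Γ Σ) (eval-⋁*-++ v w Δ Π))))

  sound : ∀ {X} → LNS 𝒜 X → Valid (𝒜 C) X
  sound (init S Γ Δ p) = plug-axiom _ S _ (schema (p₀ ⋀ p₁ ⟶ p₀ ⋁ p₂) (var p ∷ ⋀* Γ ∷ ⋁* Δ ∷ []) refl)
  sound (⊥L S Γ Δ) = plug-axiom _ S _ (schema (⊥' ⋀ p₀ ⟶ p₁) (⋀* Γ ∷ ⋁* Δ ∷ []) refl)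
  sound (⊤R S Γ Δ) = plug-axiom _ S _ (schema (p₀ ⟶ ⊤' ⋁ p₁) (⋀* Γ ∷ ⋁* Δ ∷ []) refl)
  sound (¬L S Γ Δ A d) = plug-mono _ S _ _
    (schema ((p₀ ⟶ p₂ ⋁ p₁) ⟶ (¬' p₂ ⋀ p₀ ⟶ p₁)) (⋀* Γ ∷ ⋁* Δ ∷ A ∷ []) refl) (sound d)
  sound (¬R S Γ Δ A d) = plug-mono _ S _ _
    (schema ((p₂ ⋀ p₀ ⟶ p₁) ⟶ (p₀ ⟶ ¬' p₂ ⋁ p₁)) (⋀* Γ ∷ ⋁* Δ ∷ A ∷ []) refl) (sound d)
  sound (∧L S Γ Δ A B d) = plug-mono _ S _ _
    (schema ((p₂ ⋀ (p₃ ⋀ p₀) ⟶ p₁) ⟶ ((p₂ ⋀ p₃) ⋀ p₀ ⟶ p₁)) (⋀* Γ ∷ ⋁* Δ ∷ A ∷ B ∷ []) refl) (sound d)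
  sound (∧R S Γ Δ A B d e) = plug-merge _ id S _ _ _
    (schema ((p₀ ⟶ p₂ ⋁ p₁) ⋀ (p₀ ⟶ p₃ ⋁ p₁) ⟶ (p₀ ⟶ (p₂ ⋀ p₃) ⋁ p₁)) (⋀* Γ ∷ ⋁* Δ ∷ A ∷ B ∷ []) refl)
    (sound d) (sound e)
  sound (∨L S Γ Δ A B d e) = plug-merge _ id S _ _ _
    (schema ((p₂ ⋀ p₀ ⟶ p₁) ⋀ (p₃ ⋀ p₀ ⟶ p₁) ⟶ ((p₂ ⋁ p₃) ⋀ p₀ ⟶ p₁)) (⋀* Γ ∷ ⋁* Δ ∷ A ∷ B ∷ []) refl)
    (sound d) (sound e)
  sound (∨R S Γ Δ A B d) = plug-mono _ S _ _
    (schema ((p₀ ⟶ p₂ ⋁ (p₃ ⋁ p₁)) ⟶ (p₀ ⟶ (p₂ ⋁ p₃) ⋁ p₁)) (⋀* Γ ∷ ⋁* Δ ∷ A ∷ B ∷ []) refl) (sound d)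
  sound (→L S Γ Δ A B d e) = plug-merge _ id S _ _ _
    (schema ((p₀ ⟶ p₂ ⋁ p₁) ⋀ (p₃ ⋀ p₀ ⟶ p₁) ⟶ ((p₂ ⟶ p₃) ⋀ p₀ ⟶ p₁)) (⋀* Γ ∷ ⋁* Δ ∷ A ∷ B ∷ []) refl)
    (sound d) (sound e)
  sound (→R S Γ Δ A B d) = plug-mono _ S _ _
    (schema ((p₂ ⋀ p₀ ⟶ p₃ ⋁ p₁) ⟶ (p₀ ⟶ (p₂ ⟶ p₃) ⋁ p₁)) (⋀* Γ ∷ ⋁* Δ ∷ A ∷ B ∷ []) refl) (sound d)
  sound (□Rm G Γ Δ B d) = ValidFrom-last _ G _ _ _ _ (component-□R Γ Δ B) (sound d)
  sound (□Lm G Γ Δ Σ Π A d) = Valid-□L _ id G Γ Δ Σ Π A A ⟶-refl (sound d)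
  sound (ruleC G S Γ Δ c∈𝒜 d) = Valid-C _ c∈𝒜 G S _ (sound d)
  sound (ruleN G S Γ Δ n∈𝒜 d) = Valid-N _ n∈𝒜 G S _ (sound d)
  sound (ruleP G Γ Δ p∈𝒜 d) = ValidFrom-last _ G _ _ _ _ (component-P p∈𝒜 Γ Δ) (sound d)
  sound (ruleD G Γ Δ A d∈𝒜 d) = ValidFrom-last _ G _ _ _ _ (component-D d∈𝒜 Γ Δ A) (sound d)
  sound (ruleT G Γ Δ Σ Π t∈𝒜 d) = ValidFrom-last _ G _ _ _ _ (component-T t∈𝒜 Γ Δ Σ Π) (sound d)
  sound (rule4 G Γ Δ Σ Π A 4∈𝒜 d) = Valid-□L _ id G Γ Δ Σ Π A (□ A) (ax4 4∈𝒜) (sound d)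
  sound (wL S Γ Δ A d) = anyplug-mono _ S _ _
    (schema ((p₀ ⟶ p₁) ⟶ (p₂ ⋀ p₀ ⟶ p₁)) (⋀* Γ ∷ ⋁* Δ ∷ A ∷ []) refl) (sound d)
  sound (wR S Γ Δ A d) = anyplug-mono _ S _ _
    (schema ((p₀ ⟶ p₁) ⟶ (p₀ ⟶ p₂ ⋁ p₁)) (⋀* Γ ∷ ⋁* Δ ∷ A ∷ []) refl) (sound d)
  sound (cL S Γ Δ A d) = anyplug-mono _ S _ _
    (schema ((p₂ ⋀ (p₂ ⋀ p₀) ⟶ p₁) ⟶ (p₂ ⋀ p₀ ⟶ p₁)) (⋀* Γ ∷ ⋁* Δ ∷ A ∷ []) refl) (sound d)
  sound (cR S Γ Δ A d) = anyplug-mono _ S _ _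
    (schema ((p₀ ⟶ p₂ ⋁ (p₂ ⋁ p₁)) ⟶ (p₀ ⟶ p₂ ⋁ p₁)) (⋀* Γ ∷ ⋁* Δ ∷ A ∷ []) refl) (sound d)
  sound (exch S Γ Γ' Δ Δ' Γ↭Γ' Δ↭Δ' d) = anyplug-mono _ S _ _
    (entailment⇒⊢ λ v w → subst (_≡ true) (cong₂ imp (eval-⋀*-↭ v w Γ↭Γ') (eval-⋁*-↭ v w Δ↭Δ'))) (sound d)

  soundness : ∀ A → LNS 𝒜 (lin [] ([] ⇒ [ A ])) → ⊢ A
  soundness A d with sound d
  ... | inj₁ a = mp (schema (((⊤' ⟶ p₀ ⋁ ⊥') ⋁ ⊥') ⟶ p₀) (A ∷ []) refl) a

BoxUse : Set
BoxUse = Bool × Fm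

released : BoxUse → Fm
released (true , Y) = □ Y
released (false , Y) = Y

BoxedGoal : Maybe Fm → List Fm → Set
BoxedGoal nothing Δ = ⊤
BoxedGoal (just B) Δ = □ B ∈ Δ

swap-⊆ : ∀ {x y} {L : List Fm} → x ∷ y ∷ L ⊆ y ∷ x ∷ L
swap-⊆ = ⊆-reflexive-↭ (↭.swap _ _ ↭.refl)

rotate-⊆ : ∀ {x y z} {L : List Fm} → x ∷ y ∷ z ∷ L ⊆ z ∷ x ∷ y ∷ L
rotate-⊆ (here p) = there (here p)
rotate-⊆ (there (here p)) = there (there (here p))
rotate-⊆ (there (there (here p))) = here p
rotate-⊆ (there (there (there p))) = there (there (there p))

absorb-⊆ : ∀ {x} {L : List Fm} → x ∈ L → x ∷ L ⊆ L
absorb-⊆ x∈L = ∈-∷⁺ʳ x∈L ⊆-refl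

shift-⊆ : ∀ x Γ {Γa : List Fm} → Γ ++ x ∷ Γa ⊆ x ∷ Γ ++ Γa
shift-⊆ x Γ = ⊆-reflexive-↭ (shift x Γ _)

unshift-⊆ : ∀ x Γ {Γa : List Fm} → x ∷ Γ ++ Γa ⊆ Γ ++ x ∷ Γa
unshift-⊆ x Γ = ⊆-reflexive-↭ (↭-sym (shift x Γ _))

module SequentCalculus (𝒜 : AxSet) where

  Usable : List Fm → BoxUse → Set
  Usable Γ (b , Y) = (□ Y ∈ Γ) × (b ≡ true → 𝒜 4ax ≡ true)

  -- Side conditions of the modal rule with n boxed formulas on the left and
  -- one (just B) or no (nothing) boxed formula on the right.
  ModalArity : Maybe Fm → ℕ → Set
  ModalArity (just B) n = (n ≡ 0 → 𝒜 N ≡ true) × (2 ≤ n → 𝒜 C ≡ true)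
  ModalArity nothing n =
    (𝒜 P ≡ true ⊎ 𝒜 D ≡ true) × (1 ≤ n) × (3 ≤ n → 𝒜 C ≡ true) × (n ≡ 2 → 𝒜 C ≡ true ⊎ 𝒜 D ≡ true)

  -- Principal formulas are kept
  -- in the premisses, so contraction is built in.  The modal rule gM infers
  -- Γ ⇒ Δ from Y₁', …, Yₙ' ⇒ B with □Yᵢ ∈ Γ and □B ∈ Δ (or from
  -- Y₁', …, Yₙ' ⇒ with no B), where Yᵢ' is Yᵢ or, using axiom 4, □Yᵢ.
  data Der : ℕ → List Fm → List Fm → Set where
    gax : ∀ {n Γ Δ} p → var p ∈ Γ → var p ∈ Δ → Der n Γ Δ
    g⊥ : ∀ {n Γ Δ} → ⊥' ∈ Γ → Der n Γ Δ
    g⊤ : ∀ {n Γ Δ} → ⊤' ∈ Δ → Der n Γ Δ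
    g¬L : ∀ {n Γ Δ X} → ¬' X ∈ Γ → Der n Γ (X ∷ Δ) → Der (suc n) Γ Δ
    g¬R : ∀ {n Γ Δ X} → ¬' X ∈ Δ → Der n (X ∷ Γ) Δ → Der (suc n) Γ Δ
    g∧L : ∀ {n Γ Δ X Y} → X ⋀ Y ∈ Γ → Der n (X ∷ Y ∷ Γ) Δ → Der (suc n) Γ Δ
    g∧R : ∀ {n Γ Δ X Y} → X ⋀ Y ∈ Δ → Der n Γ (X ∷ Δ) → Der n Γ (Y ∷ Δ) → Der (suc n) Γ Δ
    g∨L : ∀ {n Γ Δ X Y} → X ⋁ Y ∈ Γ → Der n (X ∷ Γ) Δ → Der n (Y ∷ Γ) Δ → Der (suc n) Γ Δ
    g∨R : ∀ {n Γ Δ X Y} → X ⋁ Y ∈ Δ → Der n Γ (X ∷ Y ∷ Δ) → Der (suc n) Γ Δ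
    g→L : ∀ {n Γ Δ X Y} → (X ⟶ Y) ∈ Γ → Der n Γ (X ∷ Δ) → Der n (Y ∷ Γ) Δ → Der (suc n) Γ Δ
    g→R : ∀ {n Γ Δ X Y} → (X ⟶ Y) ∈ Δ → Der n (X ∷ Γ) (Y ∷ Δ) → Der (suc n) Γ Δ
    gT : ∀ {n Γ Δ X} → 𝒜 T ≡ true → □ X ∈ Γ → Der n (X ∷ Γ) Δ → Der (suc n) Γ Δ
    gM : ∀ {n Γ Δ} (us : List BoxUse) (r : Maybe Fm) → ModalArity r (length us) → All (Usable Γ) us →
         BoxedGoal r Δ → Der n (map released us) (fromMaybe r) → Der (suc n) Γ Δ

  All-Usable-⊆ : ∀ {Γ Γ'} → Γ ⊆ Γ' → ∀ {us} → All (Usable Γ) us → All (Usable Γ') us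
  All-Usable-⊆ f = All.map (λ { (□Y∈Γ , 4ok) → f □Y∈Γ , 4ok })

  BoxedGoal-⊆ : ∀ {Δ Δ'} → Δ ⊆ Δ' → ∀ r → BoxedGoal r Δ → BoxedGoal r Δ'
  BoxedGoal-⊆ f nothing _ = tt
  BoxedGoal-⊆ f (just B) □B∈Δ = f □B∈Δ

  weaken : ∀ {n Γ Δ Γ' Δ'} → Γ ⊆ Γ' → Δ ⊆ Δ' → Der n Γ Δ → Der n Γ' Δ'
  weaken f g (gax p i j) = gax p (f i) (g j)
  weaken f g (g⊥ i) = g⊥ (f i)
  weaken f g (g⊤ j) = g⊤ (g j)
  weaken f g (g¬L i d) = g¬L (f i) (weaken f (∷⁺ʳ _ g) d)
  weaken f g (g¬R j d) = g¬R (g j) (weaken (∷⁺ʳ _ f) g d)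
  weaken f g (g∧L i d) = g∧L (f i) (weaken (∷⁺ʳ _ (∷⁺ʳ _ f)) g d)
  weaken f g (g∧R j d e) = g∧R (g j) (weaken f (∷⁺ʳ _ g) d) (weaken f (∷⁺ʳ _ g) e)
  weaken f g (g∨L i d e) = g∨L (f i) (weaken (∷⁺ʳ _ f) g d) (weaken (∷⁺ʳ _ f) g e)
  weaken f g (g∨R j d) = g∨R (g j) (weaken f (∷⁺ʳ _ (∷⁺ʳ _ g)) d)
  weaken f g (g→L i d e) = g→L (f i) (weaken f (∷⁺ʳ _ g) d) (weaken (∷⁺ʳ _ f) g e)
  weaken f g (g→R j d) = g→R (g j) (weaken (∷⁺ʳ _ f) (∷⁺ʳ _ g) d)
  weaken f g (gT t∈𝒜 i d) = gT t∈𝒜 (f i) (weaken (∷⁺ʳ _ f) g d)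
  weaken f g (gM us r ar oks goal d) = gM us r ar (All-Usable-⊆ f oks) (BoxedGoal-⊆ g r goal) d

  raise : ∀ {m n Γ Δ} → m ≤ n → Der m Γ Δ → Der n Γ Δ
  raise _ (gax p i j) = gax p i j
  raise _ (g⊥ i) = g⊥ i
  raise _ (g⊤ j) = g⊤ j
  raise (s≤s le) (g¬L i d) = g¬L i (raise le d)
  raise (s≤s le) (g¬R j d) = g¬R j (raise le d)
  raise (s≤s le) (g∧L i d) = g∧L i (raise le d)
  raise (s≤s le) (g∧R j d e) = g∧R j (raise le d) (raise le e)
  raise (s≤s le) (g∨L i d e) = g∨L i (raise le d) (raise le e)
  raise (s≤s le) (g∨R j d) = g∨R j (raise le d)
  raise (s≤s le) (g→L i d e) = g→L i (raise le d) (raise le e)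
  raise (s≤s le) (g→R j d) = g→R j (raise le d)
  raise (s≤s le) (gT t∈𝒜 i d) = gT t∈𝒜 i (raise le d)
  raise (s≤s le) (gM us r ar oks goal d) = gM us r ar oks goal (raise le d)

  Derivable : List Fm → List Fm → Set
  Derivable Γ Δ = ∃ λ k → Der k Γ Δ

  by : ∀ {Γ Δ Γ' Δ'} → (∀ {k} → Der k Γ Δ → Der (suc k) Γ' Δ') → Derivable Γ Δ → Derivable Γ' Δ'
  by rule (k , d) = suc k , rule d

  by₂ : ∀ {Γ₁ Δ₁ Γ₂ Δ₂ Γ Δ} → (∀ {k} → Der k Γ₁ Δ₁ → Der k Γ₂ Δ₂ → Der (suc k) Γ Δ) →
        Derivable Γ₁ Δ₁ → Derivable Γ₂ Δ₂ → Derivable Γ Δ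
  by₂ rule (k , d) (k' , e) = suc (k ⊔ k') , rule (raise (m≤m⊔n k k') d) (raise (m≤n⊔m k k') e)

  weakenᴰ : ∀ {Γ Δ Γ' Δ'} → Γ ⊆ Γ' → Δ ⊆ Δ' → Derivable Γ Δ → Derivable Γ' Δ'
  weakenᴰ f g (k , d) = k , weaken f g d

  arity-one : ∀ B → ModalArity (just B) 1
  arity-one B = (λ ()) , (λ { (s≤s ()) })

  identity : ∀ A {Γ Δ} → Derivable (A ∷ Γ) (A ∷ Δ)
  identity (var p) = 0 , gax p (here refl) (here refl)
  identity ⊥' = 0 , g⊥ (here refl)
  identity ⊤' = 0 , g⊤ (here refl)
  identity (¬' A) = by (g¬R (here refl)) (by (g¬L (there (here refl))) (identity A))
  identity (A ⋀ B) = by₂ (g∧R (here refl))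
    (by (g∧L (here refl)) (identity A))
    (by (g∧L (here refl)) (weakenᴰ swap-⊆ ⊆-refl (identity B)))
  identity (A ⋁ B) = by (g∨R (here refl))
    (by₂ (g∨L (here refl)) (identity A) (weakenᴰ ⊆-refl swap-⊆ (identity B)))
  identity (A ⟶ B) = by (g→R (here refl)) (by₂ (g→L (there (here refl))) (identity A) (identity B))
  identity (□ A) = by (gM [ false , A ] (just A) (arity-one A) ((here refl , λ ()) ∷ []) (here refl)) (identity A)
bit : Bool → ℕ
bit true = 1
bit false = 0

hits : Bool → Bool → Fm → List Fm
hits pl bx X = (if pl then [ X ] else []) ++ (if bx then [ □ X ] else [])

boxAll : List BoxUse → List BoxUse
boxAll = map (λ u → true , proj₂ u)

cutUses : Bool → Bool → List BoxUse → List BoxUse → List BoxUse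
cutUses pl bx us rest = (if pl then us else []) ++ ((if bx then boxAll us else []) ++ rest)

cutArity : Bool → Bool → ℕ → ℕ → ℕ
cutArity pl bx n k = (if pl then n else 0) + ((if bx then n else 0) + k)

length-cutUses : ∀ pl bx us rest → length (cutUses pl bx us rest) ≡ cutArity pl bx (length us) (length rest)
length-cutUses true true us rest =
  trans (length-++ us) (cong (length us +_) (trans (length-++ (boxAll us)) (cong (_+ length rest) (length-map _ us))))
length-cutUses true false us rest = length-++ us
length-cutUses false true us rest = trans (length-++ (boxAll us)) (cong (_+ length rest) (length-map _ us))
length-cutUses false false us rest = refl

cutArity≡0⇒ : ∀ pl bx n k → (pl ∨ bx) ≡ true → cutArity pl bx n k ≡ 0 → n ≡ 0
cutArity≡0⇒ true bx n k _ = m+n≡0⇒m≡0 n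
cutArity≡0⇒ false true n k _ = m+n≡0⇒m≡0 n
cutArity≡0⇒ false false n k ()

if≤bit : ∀ b n → n ≤ 1 → (if b then n else 0) ≤ bit b
if≤bit true n n≤1 = n≤1
if≤bit false n _ = z≤n

cutArity≤ : ∀ pl bx n k l → n ≤ 1 → bit pl + bit bx + k ≤ l → cutArity pl bx n k ≤ l
cutArity≤ pl bx n k l n≤1 le =
  ≤-trans (+-mono-≤ (if≤bit pl n n≤1) (+-mono-≤ (if≤bit bx n n≤1) (≤-refl {k})))
      (subst (_≤ l) (+-assoc (bit pl) (bit bx) k) le)

splitSize-rest : ∀ pl bx {k l} → bit pl + bit bx + k ≤ l → bit pl + bit bx + suc k ≤ suc l
splitSize-rest pl bx {k} le rewrite +-suc (bit pl + bit bx) k = s≤s le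

splitSize-plain : ∀ pl bx {k l} → bit pl + bit bx + k ≤ l → bit true + bit bx + k ≤ suc l
splitSize-plain true bx le = m≤n⇒m≤1+n le
splitSize-plain false bx le = s≤s le

splitSize-boxed : ∀ pl bx {k l} → bit pl + bit bx + k ≤ l → bit pl + bit true + k ≤ suc l
splitSize-boxed true true le = m≤n⇒m≤1+n le
splitSize-boxed true false le = s≤s le
splitSize-boxed false true le = m≤n⇒m≤1+n le
splitSize-boxed false false le = s≤s le

hits-plain : ∀ pl bx X {L x} → x ∈ hits pl bx X ++ L → x ∈ hits true bx X ++ L
hits-plain true bx X p = p
hits-plain false bx X p = there p

hits-boxed : ∀ pl bx X {L x} → x ∈ hits pl bx X ++ L → x ∈ hits pl true X ++ L
hits-boxed pl true X p = p
hits-boxed true false X (here refl) = here refl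
hits-boxed true false X (there p) = there (there p)
hits-boxed false false X p = there p

hits-□ : ∀ pl X {L} → □ X ∈ hits pl true X ++ L
hits-□ true X = there (here refl)
hits-□ false X = here refl

released-++ : ∀ us vs → map released us ++ map released vs ⊆ map released (us ++ vs)
released-++ us vs = ⊆-reflexive (sym (map-++ released us vs))

module CutAdmissibility (𝒜 : AxSet) where
  open SequentCalculus 𝒜

  -- The box uses of a modal rule with antecedent A ∷ Γ, sorted by whether
  -- they use A = □X plainly (pl) or boxed via axiom 4 (bx); rest uses Γ.
  data Split : Fm → List Fm → List BoxUse → Set where
    noHit : ∀ {A Γ us} → All (Usable Γ) us → Split A Γ us
    hit : ∀ {X Γ us} (pl bx : Bool) → (pl ∨ bx) ≡ true → (rest : List BoxUse) → All (Usable Γ) rest →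
          (bx ≡ true → 𝒜 4ax ≡ true) → bit pl + bit bx + length rest ≤ length us →
          map released us ⊆ hits pl bx X ++ map released rest → Split (□ X) Γ us

  split-rest : ∀ {A Γ us u} → Usable Γ u → Split A Γ us → Split A Γ (u ∷ us)
  split-rest ok (noHit oks) = noHit (ok ∷ oks)
  split-rest {u = u} ok (hit {X} pl bx some rest okr 4ok size us⊆) =
    hit pl bx some (u ∷ rest) (ok ∷ okr) 4ok (splitSize-rest pl bx size) (∈-∷⁺ʳ (∈-++⁺ʳ _ (here refl)) (++⁺ʳ _ there ∘ us⊆))

  split-hit : ∀ {X Γ us} b → (b ≡ true → 𝒜 4ax ≡ true) → Split (□ X) Γ us → Split (□ X) Γ ((b , X) ∷ us)
  split-hit false _ (noHit oks) = hit true false refl _ oks (λ ()) ≤-refl ⊆-refl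
  split-hit false _ (hit pl bx _ rest okr 4ok size us⊆) =
    hit true bx refl rest okr 4ok (splitSize-plain pl bx size) (∈-∷⁺ʳ (here refl) (hits-plain pl bx _ ∘ us⊆))
  split-hit true 4ok (noHit oks) = hit false true refl _ oks 4ok ≤-refl ⊆-refl
  split-hit {X} true 4ok (hit pl bx _ rest okr _ size us⊆) =
    hit pl true (∨-zeroʳ pl) rest okr 4ok (splitSize-boxed pl bx size) (∈-∷⁺ʳ (hits-□ pl X) (hits-boxed pl bx X ∘ us⊆))

  split : ∀ A Γ us → All (Usable (A ∷ Γ)) us → Split A Γ us
  split A Γ [] [] = noHit []
  split A Γ ((b , Y) ∷ us) ((here refl , 4ok) ∷ oks) = split-hit b 4ok (split A Γ us oks)
  split A Γ ((b , Y) ∷ us) ((there □Y∈Γ , 4ok) ∷ oks) = split-rest (□Y∈Γ , 4ok) (split A Γ us oks)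

  C-or-arity≤1 : ∀ n → (2 ≤ n → 𝒜 C ≡ true) → 𝒜 C ≡ true ⊎ n ≤ 1
  C-or-arity≤1 zero _ = inj₂ z≤n
  C-or-arity≤1 (suc zero) _ = inj₂ ≤-refl
  C-or-arity≤1 (suc (suc n)) c∈𝒜 = inj₁ (c∈𝒜 (s≤s (s≤s z≤n)))

  C-or-D-above-1 : ∀ n → 2 ≤ n → (3 ≤ n → 𝒜 C ≡ true) → (n ≡ 2 → 𝒜 C ≡ true ⊎ 𝒜 D ≡ true) → 𝒜 C ≡ true ⊎ 𝒜 D ≡ true
  C-or-D-above-1 (suc zero) (s≤s ()) _ _
  C-or-D-above-1 (suc (suc zero)) _ _ two = two refl
  C-or-D-above-1 (suc (suc (suc n))) _ three _ = inj₁ (three (s≤s (s≤s (s≤s z≤n))))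

  -- Either the left premiss has at most one box use, so the combined rule is
  -- no larger than the right one, or it has several and axiom C is present.
  -- The second alternative is the combined rule with empty antecedent and no
  -- goal, which is not a rule; its premiss ⇒ then gives the conclusion by
  -- weakening.
  ModalArity-cut : ∀ r pl bx n k l → (pl ∨ bx) ≡ true → bit pl + bit bx + k ≤ l → ModalArity r l →
                   ∀ {X} → ModalArity (just X) n → ModalArity r (cutArity pl bx n k) ⊎ (r ≡ nothing × cutArity pl bx n k ≡ 0)
  ModalArity-cut (just B) pl bx n k l some size (zero⇒N , two⇒C) (zeroᴰ⇒N , twoᴰ⇒C) =
    inj₁ ((λ z → zeroᴰ⇒N (cutArity≡0⇒ pl bx n k some z)) , two⇒C')
    where
    two⇒C' : 2 ≤ cutArity pl bx n k → 𝒜 C ≡ true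
    two⇒C' two≤ with C-or-arity≤1 n twoᴰ⇒C
    ... | inj₁ c∈𝒜 = c∈𝒜
    ... | inj₂ n≤1 = two⇒C (≤-trans two≤ (cutArity≤ pl bx n k l n≤1 size))
  ModalArity-cut nothing pl bx n k l some size (P-or-D , _ , three , two) (_ , twoᴰ⇒C) with cutArity pl bx n k in eq
  ... | zero = inj₂ (refl , refl)
  ... | suc a = inj₁ (P-or-D , s≤s z≤n , three' , two')
    where
    bounded : n ≤ 1 → suc a ≤ l
    bounded n≤1 = subst (_≤ l) eq (cutArity≤ pl bx n k l n≤1 size)
    three' : 3 ≤ suc a → 𝒜 C ≡ true
    three' three≤ with C-or-arity≤1 n twoᴰ⇒C
    ... | inj₁ c∈𝒜 = c∈𝒜
    ... | inj₂ n≤1 = three (≤-trans three≤ (bounded n≤1))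
    two' : suc a ≡ 2 → 𝒜 C ≡ true ⊎ 𝒜 D ≡ true
    two' a≡1 with C-or-arity≤1 n twoᴰ⇒C
    ... | inj₁ c∈𝒜 = inj₁ c∈𝒜
    ... | inj₂ n≤1 = C-or-D-above-1 l (subst (_≤ l) a≡1 (bounded n≤1)) three two

  All-Usable-boxAll-released : ∀ {Γ} us {L} → All (Usable Γ) us → All (Usable (map released (boxAll us) ++ L)) us
  All-Usable-boxAll-released [] [] = []
  All-Usable-boxAll-released ((b , Y) ∷ us) ((_ , 4ok) ∷ oks) =
    (here refl , 4ok) ∷ All-Usable-⊆ there (All-Usable-boxAll-released us oks)

  All-Usable-boxAll : ∀ {Γ} → 𝒜 4ax ≡ true → ∀ {us} → All (Usable Γ) us → All (Usable Γ) (boxAll us)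
  All-Usable-boxAll 4∈𝒜 [] = []
  All-Usable-boxAll 4∈𝒜 {(b , Y) ∷ us} ((□Y∈Γ , _) ∷ oks) = (□Y∈Γ , λ _ → 4∈𝒜) ∷ All-Usable-boxAll 4∈𝒜 oks

  All-Usable-cutUses : ∀ {Γ} pl bx us rest → All (Usable Γ) us → (bx ≡ true → 𝒜 4ax ≡ true) →
                       All (Usable Γ) rest → All (Usable Γ) (cutUses pl bx us rest)
  All-Usable-cutUses true true us rest oks 4ok okr = ++⁺ oks (++⁺ (All-Usable-boxAll (4ok refl) oks) okr)
  All-Usable-cutUses true false us rest oks 4ok okr = ++⁺ oks okr
  All-Usable-cutUses false true us rest oks 4ok okr = ++⁺ (All-Usable-boxAll (4ok refl) oks) okr
  All-Usable-cutUses false false us rest oks 4ok okr = okr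

  ∉-released-[] : ∀ us {x} → length us ≡ 0 → x ∈ map released us → ⊥
  ∉-released-[] [] _ ()

  modal-after-cut : ∀ {Γ Δ l} X r us rest pl bx → (pl ∨ bx) ≡ true → bit pl + bit bx + length rest ≤ l → ModalArity r l →
                    ModalArity (just X) (length us) → All (Usable Γ) us → All (Usable Γ) rest → (bx ≡ true → 𝒜 4ax ≡ true) →
                    BoxedGoal r Δ → Derivable (map released (cutUses pl bx us rest)) (fromMaybe r) → Derivable Γ Δ
  modal-after-cut {l = l} X r us rest pl bx some size ar arᴰ oks okr 4ok goal (k , d)
    with ModalArity-cut r pl bx (length us) (length rest) l some size ar {X} arᴰ
  ... | inj₁ ar' = suc k , gM (cutUses pl bx us rest) r (subst (ModalArity r) (sym (length-cutUses pl bx us rest)) ar')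
                                 (All-Usable-cutUses pl bx us rest oks 4ok okr) goal d
  ... | inj₂ (refl , empty) = k , weaken
      (⊥-elim ∘ ∉-released-[] (cutUses pl bx us rest) (trans (length-cutUses pl bx us rest) empty)) (λ ()) d

  unbox-by-T : ∀ {Γ Δ k} → 𝒜 T ≡ true → ∀ us → All (Usable Γ) us → Der k (map released us ++ Γ) Δ → Derivable Γ Δ
  unbox-by-T {k = k} _ [] [] d = k , d
  unbox-by-T t∈𝒜 ((true , Y) ∷ us) ((□Y∈Γ , _) ∷ oks) d = unbox-by-T t∈𝒜 us oks (weaken (absorb-⊆ (∈-++⁺ʳ _ □Y∈Γ)) ⊆-refl d)
  unbox-by-T t∈𝒜 ((false , Y) ∷ us) ((□Y∈Γ , _) ∷ oks) d = unbox-by-T t∈𝒜 us oks (gT t∈𝒜 (∈-++⁺ʳ _ □Y∈Γ) d)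

  data PrincipalOnRight : Fm → ℕ → List Fm → List Fm → Set where
    pr⊤ : ∀ {n Γ Δ} → PrincipalOnRight ⊤' n Γ Δ
    pr¬ : ∀ {n Γ Δ X} → Der n (X ∷ Γ) (¬' X ∷ Δ) → PrincipalOnRight (¬' X) (suc n) Γ Δ
    pr∧ : ∀ {n Γ Δ X Y} → Der n Γ (X ∷ X ⋀ Y ∷ Δ) → Der n Γ (Y ∷ X ⋀ Y ∷ Δ) → PrincipalOnRight (X ⋀ Y) (suc n) Γ Δ
    pr∨ : ∀ {n Γ Δ X Y} → Der n Γ (X ∷ Y ∷ (X ⋁ Y) ∷ Δ) → PrincipalOnRight (X ⋁ Y) (suc n) Γ Δ
    pr→ : ∀ {n Γ Δ X Y} → Der n (X ∷ Γ) (Y ∷ (X ⟶ Y) ∷ Δ) → PrincipalOnRight (X ⟶ Y) (suc n) Γ Δ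
    pr□ : ∀ {n Γ Δ X} us → ModalArity (just X) (length us) → All (Usable Γ) us → Der n (map released us) [ X ] →
          PrincipalOnRight (□ X) (suc n) Γ Δ

  -- Induction on the cut formula, then on the heights of the two premisses.
  -- cut-principal takes over when the left premiss introduces the cut
  -- formula, cut-modal when moreover the right premiss ends with gM.
  mutual
    cutᴰ : ∀ A {Γ Δ} → Derivable Γ (A ∷ Δ) → Derivable (A ∷ Γ) Δ → Derivable Γ Δ
    cutᴰ A (n , d) (m , e) = cut A n m d e

    cut : ∀ A n m {Γ Δ} → Der n Γ (A ∷ Δ) → Der m (A ∷ Γ) Δ → Derivable Γ Δ
    cut A n m (gax p i (here refl)) e = m , weaken (absorb-⊆ i) ⊆-refl e
    cut A n m (gax p i (there j)) e = 0 , gax p i j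
    cut A n m (g⊥ i) e = 0 , g⊥ i
    cut A n m d@(g⊤ (here refl)) e = cut-principal A n m d pr⊤ e
    cut A n m (g⊤ (there j)) e = 0 , g⊤ j
    cut A (suc n) m (g¬L i d₁) e = by (g¬L i) (cut A n m (weaken ⊆-refl swap-⊆ d₁) (weaken ⊆-refl there e))
    cut A (suc n) m d@(g¬R (here refl) d₁) e = cut-principal A (suc n) m d (pr¬ d₁) e
    cut A (suc n) m (g¬R (there j) d₁) e = by (g¬R j) (cut A n m d₁ (weaken (∷⁺ʳ _ there) ⊆-refl e))
    cut A (suc n) m (g∧L i d₁) e = by (g∧L i) (cut A n m d₁ (weaken (∷⁺ʳ _ (there ∘ there)) ⊆-refl e))
    cut A (suc n) m d@(g∧R (here refl) d₁ d₂) e = cut-principal A (suc n) m d (pr∧ d₁ d₂) e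
    cut A (suc n) m (g∧R (there j) d₁ d₂) e = by₂ (g∧R j)
      (cut A n m (weaken ⊆-refl swap-⊆ d₁) (weaken ⊆-refl there e))
      (cut A n m (weaken ⊆-refl swap-⊆ d₂) (weaken ⊆-refl there e))
    cut A (suc n) m (g∨L i d₁ d₂) e = by₂ (g∨L i)
      (cut A n m d₁ (weaken (∷⁺ʳ _ there) ⊆-refl e)) (cut A n m d₂ (weaken (∷⁺ʳ _ there) ⊆-refl e))
    cut A (suc n) m d@(g∨R (here refl) d₁) e = cut-principal A (suc n) m d (pr∨ d₁) e
    cut A (suc n) m (g∨R (there j) d₁) e = by (g∨R j)
      (cut A n m (weaken ⊆-refl rotate-⊆ d₁) (weaken ⊆-refl (there ∘ there) e))
    cut A (suc n) m (g→L i d₁ d₂) e = by₂ (g→L i)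
      (cut A n m (weaken ⊆-refl swap-⊆ d₁) (weaken ⊆-refl there e)) (cut A n m d₂ (weaken (∷⁺ʳ _ there) ⊆-refl e))
    cut A (suc n) m d@(g→R (here refl) d₁) e = cut-principal A (suc n) m d (pr→ d₁) e
    cut A (suc n) m (g→R (there j) d₁) e = by (g→R j) (cut A n m (weaken ⊆-refl swap-⊆ d₁) (weaken (∷⁺ʳ _ there) there e))
    cut A (suc n) m (gT t∈𝒜 i d₁) e = by (gT t∈𝒜 i) (cut A n m d₁ (weaken (∷⁺ʳ _ there) ⊆-refl e))
    cut A (suc n) m (gM us nothing ar oks _ d₁) e = suc n , gM us nothing ar oks tt d₁
    cut A (suc n) m d@(gM us (just B) ar oks (here refl) d₁) e = cut-principal A (suc n) m d (pr□ us ar oks d₁) e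
    cut A (suc n) m (gM us (just B) ar oks (there j) d₁) e = suc n , gM us (just B) ar oks j d₁

    cut-principal : ∀ A n m {Γ Δ} → Der n Γ (A ∷ Δ) → PrincipalOnRight A n Γ Δ → Der m (A ∷ Γ) Δ → Derivable Γ Δ
    cut-principal A n m d () (gax p (here refl) j)
    cut-principal A n m d pr (gax p (there i) j) = 0 , gax p i j
    cut-principal A n m d () (g⊥ (here refl))
    cut-principal A n m d pr (g⊥ (there i)) = 0 , g⊥ i
    cut-principal A n m d pr (g⊤ j) = 0 , g⊤ j
    cut-principal A zero (suc m) d pr⊤ (g¬L (here ()) e₁)
    cut-principal A zero (suc m) d pr⊤ (g∧L (here ()) e₁)
    cut-principal A zero (suc m) d pr⊤ (g∨L (here ()) e₁ e₂)
    cut-principal A zero (suc m) d pr⊤ (g→L (here ()) e₁ e₂)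
    cut-principal A zero (suc m) d pr⊤ (gT t∈𝒜 (here ()) e₁)
    cut-principal A (suc n) (suc m) d (pr¬ {X = X} d₁) e@(g¬L (here refl) e₁) =
      cutᴰ X (cut A (suc n) m (weaken ⊆-refl (∷⁺ʳ _ there) d) e₁) (cut A n (suc m) d₁ (weaken (∷⁺ʳ _ there) ⊆-refl e))
    cut-principal A n (suc m) d pr (g¬L (there i) e₁) = by (g¬L i) (cut A n m (weaken ⊆-refl (∷⁺ʳ _ there) d) e₁)
    cut-principal A n (suc m) d pr (g¬R j e₁) = by (g¬R j) (cut A n m (weaken there ⊆-refl d) (weaken swap-⊆ ⊆-refl e₁))
    cut-principal A (suc n) (suc m) d (pr∧ {X = X} {Y} d₁ d₂) e@(g∧L (here refl) e₁) =
      cutᴰ Y (cut A n (suc m) (weaken ⊆-refl swap-⊆ d₂) (weaken ⊆-refl there e))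
        (cutᴰ X (weakenᴰ there ⊆-refl (cut A n (suc m) (weaken ⊆-refl swap-⊆ d₁) (weaken ⊆-refl there e)))
                (cut A (suc n) m (weaken (there ∘ there) ⊆-refl d) (weaken rotate-⊆ ⊆-refl e₁)))
    cut-principal A n (suc m) d pr (g∧L (there i) e₁) =
      by (g∧L i) (cut A n m (weaken (there ∘ there) ⊆-refl d) (weaken rotate-⊆ ⊆-refl e₁))
    cut-principal A n (suc m) d pr (g∧R j e₁ e₂) = by₂ (g∧R j)
      (cut A n m (weaken ⊆-refl (∷⁺ʳ _ there) d) e₁) (cut A n m (weaken ⊆-refl (∷⁺ʳ _ there) d) e₂)
    cut-principal A (suc n) (suc m) d (pr∨ {X = X} {Y} d₁) e@(g∨L (here refl) e₁ e₂) =
      cutᴰ Y (cutᴰ X (cut A n (suc m) (weaken ⊆-refl rotate-⊆ d₁) (weaken ⊆-refl (there ∘ there) e))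
                     (weakenᴰ ⊆-refl there (cut A (suc n) m (weaken there ⊆-refl d) (weaken swap-⊆ ⊆-refl e₁))))
             (cut A (suc n) m (weaken there ⊆-refl d) (weaken swap-⊆ ⊆-refl e₂))
    cut-principal A n (suc m) d pr (g∨L (there i) e₁ e₂) = by₂ (g∨L i)
      (cut A n m (weaken there ⊆-refl d) (weaken swap-⊆ ⊆-refl e₁))
      (cut A n m (weaken there ⊆-refl d) (weaken swap-⊆ ⊆-refl e₂))
    cut-principal A n (suc m) d pr (g∨R j e₁) = by (g∨R j) (cut A n m (weaken ⊆-refl (∷⁺ʳ _ (there ∘ there)) d) e₁)
    cut-principal A (suc n) (suc m) d (pr→ {X = X} {Y} d₁) e@(g→L (here refl) e₁ e₂) =
      cutᴰ Y (cutᴰ X (weakenᴰ ⊆-refl (∷⁺ʳ _ there) (cut A (suc n) m (weaken ⊆-refl (∷⁺ʳ _ there) d) e₁))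
                     (cut A n (suc m) (weaken ⊆-refl swap-⊆ d₁) (weaken (∷⁺ʳ _ there) there e)))
             (cut A (suc n) m (weaken there ⊆-refl d) (weaken swap-⊆ ⊆-refl e₂))
    cut-principal A n (suc m) d pr (g→L (there i) e₁ e₂) = by₂ (g→L i)
      (cut A n m (weaken ⊆-refl (∷⁺ʳ _ there) d) e₁) (cut A n m (weaken there ⊆-refl d) (weaken swap-⊆ ⊆-refl e₂))
    cut-principal A n (suc m) d pr (g→R j e₁) = by (g→R j)
      (cut A n m (weaken there (∷⁺ʳ _ there) d) (weaken swap-⊆ ⊆-refl e₁))
    cut-principal A (suc n) (suc m) d (pr□ {X = X} us ar oks d₁) (gT t∈𝒜 (here refl) e₁) =
      cutᴰ X (unbox-by-T t∈𝒜 us oks (weaken ∈-++⁺ˡ (∷⁺ʳ _ (λ ())) d₁))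
             (cut A (suc n) m (weaken there ⊆-refl d) (weaken swap-⊆ ⊆-refl e₁))
    cut-principal A n (suc m) d pr (gT t∈𝒜 (there i) e₁) = by (gT t∈𝒜 i)
      (cut A n m (weaken there ⊆-refl d) (weaken swap-⊆ ⊆-refl e₁))
    cut-principal A n (suc m) {Γ} d pr (gM us r ar oks goal e₁) = cut-modal A n m d pr us r ar goal e₁ (split A Γ us oks)

    cut-modal : ∀ A n m {Γ Δ} → Der n Γ (A ∷ Δ) → PrincipalOnRight A n Γ Δ → ∀ us r → ModalArity r (length us) →
                BoxedGoal r Δ → Der m (map released us) (fromMaybe r) → Split A Γ us → Derivable Γ Δ
    cut-modal A n m d pr us r ar goal e (noHit oks) = suc m , gM us r ar oks goal e
    cut-modal A (suc n) m d (pr□ {X = X} usᴰ arᴰ oksᴰ d₁) us r ar goal e (hit true false some rest okr 4ok size us⊆) =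
      modal-after-cut X r usᴰ rest true false some size ar arᴰ oksᴰ okr 4ok goal
        (weakenᴰ (released-++ usᴰ rest) ⊆-refl
          (cut X n m (weaken ∈-++⁺ˡ (∷⁺ʳ _ (λ ())) d₁) (weaken (∷⁺ʳ _ (∈-++⁺ʳ _) ∘ us⊆) ⊆-refl e)))
    cut-modal A (suc n) m d (pr□ {X = X} usᴰ arᴰ oksᴰ d₁) us r ar goal e (hit false true some rest okr 4ok size us⊆) =
      modal-after-cut X r usᴰ rest false true some size ar arᴰ oksᴰ okr 4ok goal
        (weakenᴰ (released-++ (boxAll usᴰ) rest) ⊆-refl
          (cut A (suc n) m (gM usᴰ (just X) arᴰ (All-Usable-boxAll-released usᴰ oksᴰ) (here refl) d₁)
                           (weaken (∷⁺ʳ _ (∈-++⁺ʳ _) ∘ us⊆) ⊆-refl e)))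
    cut-modal A (suc n) m d (pr□ {X = X} usᴰ arᴰ oksᴰ d₁) us r ar goal e (hit true true some rest okr 4ok size us⊆) =
      modal-after-cut X r usᴰ rest true true some size ar arᴰ oksᴰ okr 4ok goal
        (weakenᴰ (⊆-trans (++⁺ʳ (map released usᴰ) (released-++ (boxAll usᴰ) rest))
            (released-++ usᴰ (boxAll usᴰ ++ rest))) ⊆-refl
          (cutᴰ X (n , weaken ∈-++⁺ˡ (∷⁺ʳ _ (λ ())) d₁)
                  (weakenᴰ (∷⁺ʳ _ (∈-++⁺ʳ (map released usᴰ))) ⊆-refl
                    (cut A (suc n) m (gM usᴰ (just X) arᴰ (All-Usable-⊆ there (All-Usable-boxAll-released usᴰ oksᴰ))
                        (here refl) d₁)
                                     (weaken (⊆-trans us⊆ (swap-⊆ ∘ ∷⁺ʳ _ (∷⁺ʳ _ (∈-++⁺ʳ _)))) ⊆-refl e)))))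

_==_ : Fm → Fm → Bool
var x == var y = x ℕ.≡ᵇ y
⊥' == ⊥' = true
⊤' == ⊤' = true
(¬' A) == (¬' B) = A == B
(A ⋀ B) == (A' ⋀ B') = (A == A') ∧ (B == B')
(A ⋁ B) == (A' ⋁ B') = (A == A') ∧ (B == B')
(A ⟶ B) == (A' ⟶ B') = (A == A') ∧ (B == B')
(□ A) == (□ B) = A == B
_ == _ = false

==-sound : ∀ A B → (A == B) ≡ true → A ≡ B
==-sound (var x) (var y) h = cong var (≡ᵇ⇒≡ x y (Equivalence.from T-≡ h))
==-sound ⊥' ⊥' h = refl
==-sound ⊤' ⊤' h = refl
==-sound (¬' A) (¬' B) h = cong ¬'_ (==-sound A B h)
==-sound (A ⋀ B) (A' ⋀ B') h = cong₂ _⋀_ (==-sound A A' (proj₁ (∧-true⁻ h))) (==-sound B B' (proj₂ (∧-true⁻ h)))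
==-sound (A ⋁ B) (A' ⋁ B') h = cong₂ _⋁_ (==-sound A A' (proj₁ (∧-true⁻ h))) (==-sound B B' (proj₂ (∧-true⁻ h)))
==-sound (A ⟶ B) (A' ⟶ B') h = cong₂ _⟶_ (==-sound A A' (proj₁ (∧-true⁻ h))) (==-sound B B' (proj₂ (∧-true⁻ h)))
==-sound (□ A) (□ B) h = cong □_ (==-sound A B h)

==-refl : ∀ A → (A == A) ≡ true
==-refl (var x) = Equivalence.to T-≡ (≡⇒≡ᵇ x x refl)
==-refl ⊥' = refl
==-refl ⊤' = refl
==-refl (¬' A) = ==-refl A
==-refl (A ⋀ B) = cong₂ _∧_ (==-refl A) (==-refl B)
==-refl (A ⋁ B) = cong₂ _∧_ (==-refl A) (==-refl B)
==-refl (A ⟶ B) = cong₂ _∧_ (==-refl A) (==-refl B)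
==-refl (□ A) = ==-refl A

_≟_ : DecidableEquality Fm
A ≟ B with A == B in e
... | true = yes (==-sound A B e)
... | false = no λ { refl → case trans (sym e) (==-refl A) of λ () }

open import Data.List.Membership.DecPropositional _≟_ using (_∈?_)

mutual
  size : Fm → ℕ
  size A = suc (rank A)

  rank : Fm → ℕ
  rank (var x) = 0
  rank ⊥' = 0
  rank ⊤' = 0
  rank (¬' A) = size A
  rank (A ⋀ B) = size A + size B
  rank (A ⋁ B) = size A + size B
  rank (A ⟶ B) = size A + size B
  rank (□ A) = 0

size* : List Fm → ℕ
size* [] = 0
size* (A ∷ Γ) = size A + size* Γ

weight : List Fm → List Fm → ℕ
weight Γ Δ = size* Γ + size* Δ

weight-¬L : ∀ A Γ Δ {f} → weight (¬' A ∷ Γ) Δ ≤ suc f → weight Γ (A ∷ Δ) ≤ f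
weight-¬L A Γ Δ (s≤s le) = ≤-trans (≤-reflexive (rearrange (size A) (size* Γ) (size* Δ))) le
  where
  rearrange : ∀ a g d → g + (a + d) ≡ (a + g) + d
  rearrange = solve-∀

weight-∧L : ∀ A B Γ Δ {f} → weight (A ⋀ B ∷ Γ) Δ ≤ suc f → weight (A ∷ B ∷ Γ) Δ ≤ f
weight-∧L A B Γ Δ (s≤s le) = ≤-trans (≤-reflexive (rearrange (size A) (size B) (size* Γ) (size* Δ))) le
  where
  rearrange : ∀ a b g d → (a + (b + g)) + d ≡ ((a + b) + g) + d
  rearrange = solve-∀

weight-∨L : ∀ A B Γ Δ {f} → weight ((A ⋁ B) ∷ Γ) Δ ≤ suc f → weight (A ∷ Γ) Δ ≤ f × weight (B ∷ Γ) Δ ≤ f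
weight-∨L A B Γ Δ (s≤s le) =
  ≤-trans (+-monoˡ-≤ (size* Δ) (+-monoˡ-≤ (size* Γ) (m≤m+n (size A) (size B)))) le ,
  ≤-trans (+-monoˡ-≤ (size* Δ) (+-monoˡ-≤ (size* Γ) (m≤n+m (size B) (size A)))) le

weight-→L : ∀ A B Γ Δ {f} → weight ((A ⟶ B) ∷ Γ) Δ ≤ suc f → weight Γ (A ∷ Δ) ≤ f × weight (B ∷ Γ) Δ ≤ f
weight-→L A B Γ Δ le with weight-∨L A B Γ Δ le
... | leA , leB = weight-¬L A Γ Δ (s≤s leA) , leB

weight-¬R : ∀ A Δ {f} → weight [] (¬' A ∷ Δ) ≤ suc f → weight [ A ] Δ ≤ f
weight-¬R A Δ (s≤s le) = ≤-trans (≤-reflexive (cong (_+ size* Δ) (+-identityʳ (size A)))) le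

weight-∧R : ∀ A B Δ {f} → weight [] (A ⋀ B ∷ Δ) ≤ suc f → weight [] (A ∷ Δ) ≤ f × weight [] (B ∷ Δ) ≤ f
weight-∧R A B Δ (s≤s le) =
  ≤-trans (+-monoˡ-≤ (size* Δ) (m≤m+n (size A) (size B))) le ,
  ≤-trans (+-monoˡ-≤ (size* Δ) (m≤n+m (size B) (size A))) le

weight-∨R : ∀ A B Δ {f} → weight [] ((A ⋁ B) ∷ Δ) ≤ suc f → weight [] (A ∷ B ∷ Δ) ≤ f
weight-∨R A B Δ (s≤s le) = ≤-trans (≤-reflexive (sym (+-assoc (size A) (size B) (size* Δ)))) le

weight-→R : ∀ A B Δ {f} → weight [] ((A ⟶ B) ∷ Δ) ≤ suc f → weight [ A ] (B ∷ Δ) ≤ f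
weight-→R A B Δ (s≤s le) = ≤-trans (≤-reflexive (rearrange (size A) (size B) (size* Δ))) le
  where
  rearrange : ∀ a b d → (a + 0) + (b + d) ≡ (a + b) + d
  rearrange = solve-∀

data Atomic : Fm → Set where
  var : ∀ p → Atomic (var p)
  box : ∀ A → Atomic (□ A)

Holds : (ℕ → Bool) → (Fm → Bool) → Fm → Set
Holds v w A = eval v w A ≡ true

Entails : List Fm → List Fm → Set
Entails Γ Δ = ∀ v w → All (Holds v w) Γ → Any (Holds v w) Δ

Entails-⊆ : ∀ {Γ Γ' Δ Δ'} → Γ ⊆ Γ' → Δ ⊆ Δ' → Entails Γ Δ → Entails Γ' Δ'
Entails-⊆ f g h v w γ = Any-resp-⊆ g (h v w (All-resp-⊇ f γ))

∧-true⁺ : ∀ {a b} → a ≡ true → b ≡ true → (a ∧ b) ≡ true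
∧-true⁺ refl refl = refl

∨-true⁻ : ∀ {a b} → (a ∨ b) ≡ true → a ≡ true ⊎ b ≡ true
∨-true⁻ {true} _ = inj₁ refl
∨-true⁻ {false} h = inj₂ h

∨-true⁺ʳ : ∀ {a b} → b ≡ true → (a ∨ b) ≡ true
∨-true⁺ʳ {a} refl = ∨-zeroʳ a

imp-false : ∀ {a b} → a ≡ false → imp a b ≡ true
imp-false refl = refl

imp-elim : ∀ {a b} → a ≡ true → imp a b ≡ true → b ≡ true
imp-elim refl h = h

Entails-⊤L : ∀ {Γ Δ} → Entails (⊤' ∷ Γ) Δ → Entails Γ Δ
Entails-⊤L h v w γ = h v w (refl ∷ γ)

Entails-⊥R : ∀ {Γ Δ} → Entails Γ (⊥' ∷ Δ) → Entails Γ Δ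
Entails-⊥R h v w γ with h v w γ
... | there δ = δ

Entails-¬L : ∀ {A Γ Δ} → Entails (¬' A ∷ Γ) Δ → Entails Γ (A ∷ Δ)
Entails-¬L {A} h v w γ with eval v w A in e
... | true = here e
... | false = there (h v w (cong not e ∷ γ))

Entails-¬R : ∀ {A Γ Δ} → Entails Γ (¬' A ∷ Δ) → Entails (A ∷ Γ) Δ
Entails-¬R {A} h v w (a ∷ γ) with h v w γ
... | there δ = δ
... | here ¬a = case trans (sym (cong not a)) ¬a of λ ()

Entails-∧L : ∀ {A B Γ Δ} → Entails (A ⋀ B ∷ Γ) Δ → Entails (A ∷ B ∷ Γ) Δ
Entails-∧L h v w (a ∷ b ∷ γ) = h v w (∧-true⁺ a b ∷ γ)

Any-replaceHead : ∀ {P : Fm → Set} {x y xs} → (P x → P y) → Any P (x ∷ xs) → Any P (y ∷ xs)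
Any-replaceHead f (here px) = here (f px)
Any-replaceHead f (there p) = there p

Entails-∧R : ∀ {A B Γ Δ} → Entails Γ (A ⋀ B ∷ Δ) → Entails Γ (A ∷ Δ) × Entails Γ (B ∷ Δ)
Entails-∧R h = (λ v w γ → Any-replaceHead (proj₁ ∘ ∧-true⁻) (h v w γ)) ,
               (λ v w γ → Any-replaceHead (proj₂ ∘ ∧-true⁻) (h v w γ))

Entails-∨L : ∀ {A B Γ Δ} → Entails ((A ⋁ B) ∷ Γ) Δ → Entails (A ∷ Γ) Δ × Entails (B ∷ Γ) Δ
Entails-∨L h = (λ { v w (a ∷ γ) → h v w (cong (_∨ _) a ∷ γ) }) , (λ { v w (b ∷ γ) → h v w (∨-true⁺ʳ b ∷ γ) })

Entails-∨R : ∀ {A B Γ Δ} → Entails Γ ((A ⋁ B) ∷ Δ) → Entails Γ (A ∷ B ∷ Δ)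
Entails-∨R h v w γ with h v w γ
... | there δ = there (there δ)
... | here ab with ∨-true⁻ ab
...   | inj₁ a = here a
...   | inj₂ b = there (here b)

Entails-→L : ∀ {A B Γ Δ} → Entails ((A ⟶ B) ∷ Γ) Δ → Entails Γ (A ∷ Δ) × Entails (B ∷ Γ) Δ
Entails-→L {A} h = premise₁ , (λ { v w (b ∷ γ) → h v w (∨-true⁺ʳ b ∷ γ) })
  where
  premise₁ : Entails _ (A ∷ _)
  premise₁ v w γ with eval v w A in e
  ... | true = here e
  ... | false = there (h v w (imp-false e ∷ γ))

Entails-→R : ∀ {A B Γ Δ} → Entails Γ ((A ⟶ B) ∷ Δ) → Entails (A ∷ Γ) (B ∷ Δ)
Entails-→R h v w (a ∷ γ) = Any-replaceHead (imp-elim a) (h v w γ)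

-- The canonical countermodel of an atomic sequent Γ ⇒ Δ: exactly the atoms
-- and boxed formulas of Γ are true.
atomValuation : List Fm → ℕ → Bool
atomValuation Γ p = does (var p ∈? Γ)

boxValuation : List Fm → Fm → Bool
boxValuation Γ B = does (□ B ∈? Γ)

eval-atomic : ∀ Γ {x} → Atomic x → eval (atomValuation Γ) (boxValuation Γ) x ≡ does (x ∈? Γ)
eval-atomic Γ (var p) = refl
eval-atomic Γ (box B) = refl

disjoint-atomic-⊭ : ∀ {Γ Δ} → All Atomic Γ → All Atomic Δ → All (_∉ Γ) Δ → ¬ Entails Γ Δ
disjoint-atomic-⊭ {Γ} atΓ atΔ disjoint Γ⊨Δ with find (Γ⊨Δ (atomValuation Γ) (boxValuation Γ) (All.tabulate holdsInΓ))
  where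
  holdsInΓ : ∀ {x} → x ∈ Γ → Holds (atomValuation Γ) (boxValuation Γ) x
  holdsInΓ x∈Γ = trans (eval-atomic Γ (All.lookup atΓ x∈Γ)) (dec-true (_ ∈? Γ) x∈Γ)
... | x , x∈Δ , holds = case trans (sym holds) falseInΔ of λ ()
  where
  falseInΔ : eval (atomValuation Γ) (boxValuation Γ) x ≡ false
  falseInΔ = trans (eval-atomic Γ (All.lookup atΔ x∈Δ)) (dec-false (x ∈? Γ) (All.lookup disjoint x∈Δ))

module PropositionalCompleteness (𝒜 : AxSet) where
  open SequentCalculus 𝒜

  atomic-complete : ∀ {Γ Δ} → All Atomic Γ → All Atomic Δ → Entails Γ Δ → Derivable Γ Δ
  atomic-complete {Γ} {Δ} atΓ atΔ Γ⊨Δ with any? (_∈? Γ) Δ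
  ... | no disjoint = ⊥-elim (disjoint-atomic-⊭ atΓ atΔ (¬Any⇒All¬ Δ disjoint) Γ⊨Δ)
  ... | yes shared with find shared
  ...   | x , x∈Δ , x∈Γ with All.lookup atΔ x∈Δ
  ...     | var p = 0 , gax p x∈Γ x∈Δ
  ...     | box B = weakenᴰ (absorb-⊆ x∈Γ) (absorb-⊆ x∈Δ) (identity (□ B))

  moveˡ : ∀ x Γ {Γa Δ} → (Entails (Γ ++ x ∷ Γa) Δ → Derivable (Γ ++ x ∷ Γa) Δ) →
          Entails (x ∷ Γ ++ Γa) Δ → Derivable (x ∷ Γ ++ Γa) Δ
  moveˡ x Γ k h = weakenᴰ (shift-⊆ x Γ) ⊆-refl (k (Entails-⊆ (unshift-⊆ x Γ) ⊆-refl h))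

  moveʳ : ∀ x Δ {Γ Δa} → (Entails Γ (Δ ++ x ∷ Δa) → Derivable Γ (Δ ++ x ∷ Δa)) →
          Entails Γ (x ∷ Δ ++ Δa) → Derivable Γ (x ∷ Δ ++ Δa)
  moveʳ x Δ k h = weakenᴰ ⊆-refl (shift-⊆ x Δ) (k (Entails-⊆ ⊆-refl (unshift-⊆ x Δ) h))

  -- Root-first proof search: the formulas of Γ and Δ are decomposed in turn,
  -- atoms and boxed formulas being set aside in Γa and Δa; every rule is
  -- semantically invertible, so the sequent stays valid.
  complete : ∀ f Γ Δ {Γa Δa} → All Atomic Γa → All Atomic Δa → weight Γ Δ ≤ f →
             Entails (Γ ++ Γa) (Δ ++ Δa) → Derivable (Γ ++ Γa) (Δ ++ Δa)
  complete f [] [] atΓ atΔ _ = atomic-complete atΓ atΔ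
  complete zero (A ∷ Γ) Δ _ _ ()
  complete zero [] (A ∷ Δ) _ _ ()
  complete (suc f) (var p ∷ Γ) Δ atΓ atΔ (s≤s le) = moveˡ (var p) Γ (complete f Γ Δ (var p ∷ atΓ) atΔ le)
  complete (suc f) (□ A ∷ Γ) Δ atΓ atΔ (s≤s le) = moveˡ (□ A) Γ (complete f Γ Δ (box A ∷ atΓ) atΔ le)
  complete (suc f) (⊥' ∷ Γ) Δ atΓ atΔ _ _ = 0 , g⊥ (here refl)
  complete (suc f) (⊤' ∷ Γ) Δ atΓ atΔ (s≤s le) h =
    weakenᴰ there ⊆-refl (complete f Γ Δ atΓ atΔ le (Entails-⊤L h))
  complete (suc f) (¬' A ∷ Γ) Δ atΓ atΔ le h = by (g¬L (here refl))
    (weakenᴰ there ⊆-refl (complete f Γ (A ∷ Δ) atΓ atΔ (weight-¬L A Γ Δ le) (Entails-¬L h)))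
  complete (suc f) (A ⋀ B ∷ Γ) Δ atΓ atΔ le h = by (g∧L (here refl))
    (weakenᴰ (∷⁺ʳ _ (∷⁺ʳ _ there)) ⊆-refl (complete f (A ∷ B ∷ Γ) Δ atΓ atΔ (weight-∧L A B Γ Δ le) (Entails-∧L h)))
  complete (suc f) ((A ⋁ B) ∷ Γ) Δ atΓ atΔ le h = by₂ (g∨L (here refl))
    (weakenᴰ (∷⁺ʳ _ there) ⊆-refl (complete f (A ∷ Γ) Δ atΓ atΔ (proj₁ (weight-∨L A B Γ Δ le)) (proj₁ (Entails-∨L h))))
    (weakenᴰ (∷⁺ʳ _ there) ⊆-refl (complete f (B ∷ Γ) Δ atΓ atΔ (proj₂ (weight-∨L A B Γ Δ le)) (proj₂ (Entails-∨L h))))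
  complete (suc f) ((A ⟶ B) ∷ Γ) Δ atΓ atΔ le h = by₂ (g→L (here refl))
    (weakenᴰ there ⊆-refl (complete f Γ (A ∷ Δ) atΓ atΔ (proj₁ (weight-→L A B Γ Δ le)) (proj₁ (Entails-→L h))))
    (weakenᴰ (∷⁺ʳ _ there) ⊆-refl (complete f (B ∷ Γ) Δ atΓ atΔ (proj₂ (weight-→L A B Γ Δ le)) (proj₂ (Entails-→L h))))
  complete (suc f) [] (var p ∷ Δ) atΓ atΔ (s≤s le) = moveʳ (var p) Δ (complete f [] Δ atΓ (var p ∷ atΔ) le)
  complete (suc f) [] (□ A ∷ Δ) atΓ atΔ (s≤s le) = moveʳ (□ A) Δ (complete f [] Δ atΓ (box A ∷ atΔ) le)
  complete (suc f) [] (⊤' ∷ Δ) atΓ atΔ _ _ = 0 , g⊤ (here refl)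
  complete (suc f) [] (⊥' ∷ Δ) atΓ atΔ (s≤s le) h =
    weakenᴰ ⊆-refl there (complete f [] Δ atΓ atΔ le (Entails-⊥R h))
  complete (suc f) [] (¬' A ∷ Δ) atΓ atΔ le h = by (g¬R (here refl))
    (weakenᴰ ⊆-refl there (complete f [ A ] Δ atΓ atΔ (weight-¬R A Δ le) (Entails-¬R h)))
  complete (suc f) [] (A ⋀ B ∷ Δ) atΓ atΔ le h = by₂ (g∧R (here refl))
    (weakenᴰ ⊆-refl (∷⁺ʳ _ there) (complete f [] (A ∷ Δ) atΓ atΔ (proj₁ (weight-∧R A B Δ le)) (proj₁ (Entails-∧R h))))
    (weakenᴰ ⊆-refl (∷⁺ʳ _ there) (complete f [] (B ∷ Δ) atΓ atΔ (proj₂ (weight-∧R A B Δ le)) (proj₂ (Entails-∧R h))))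
  complete (suc f) [] ((A ⋁ B) ∷ Δ) atΓ atΔ le h = by (g∨R (here refl))
    (weakenᴰ ⊆-refl (∷⁺ʳ _ (∷⁺ʳ _ there)) (complete f [] (A ∷ B ∷ Δ) atΓ atΔ (weight-∨R A B Δ le) (Entails-∨R h)))
  complete (suc f) [] ((A ⟶ B) ∷ Δ) atΓ atΔ le h = by (g→R (here refl))
    (weakenᴰ ⊆-refl (∷⁺ʳ _ there) (complete f [ A ] (B ∷ Δ) atΓ atΔ (weight-→R A B Δ le) (Entails-→R h)))

  tautology⇒derivable : ∀ A → Tautology A → Derivable [] [ A ]
  tautology⇒derivable A ⊨A = complete (weight [] [ A ]) [] [ A ] [] [] ≤-refl (λ v w _ → here (⊨A v w))

module HilbertToSequent (𝒜 : AxSet) where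
  open SequentCalculus 𝒜
  open CutAdmissibility 𝒜
  open PropositionalCompleteness 𝒜

  □-rule : ∀ {Γ Δ} X Y → □ X ∈ Γ → □ Y ∈ Δ → Derivable [ X ] [ Y ] → Derivable Γ Δ
  □-rule X Y □X∈Γ □Y∈Δ = by (gM [ false , X ] (just Y) (arity-one Y) ((□X∈Γ , λ ()) ∷ []) □Y∈Δ)

  ⟶-invert : ∀ A B → Derivable [] [ A ⟶ B ] → Derivable [ A ] [ B ]
  ⟶-invert A B ⊢A⟶B = cutᴰ (A ⟶ B) (weakenᴰ (λ ()) (∷⁺ʳ _ (λ ())) ⊢A⟶B)
    (by₂ (g→L (here refl)) (weakenᴰ there ⊆-refl (identity A)) (identity B))

  hilbert⇒derivable : ∀ {A} → Thm 𝒜 A → Derivable [] [ A ]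
  hilbert⇒derivable {A} (taut ⊨A) = tautology⇒derivable A ⊨A
  hilbert⇒derivable (axM {A} {B}) = by (g→R (here refl)) (by₂ (g∧R (here refl))
    (□-rule (A ⋀ B) A (here refl) (here refl) (by (g∧L (here refl)) (identity A)))
    (□-rule (A ⋀ B) B (here refl) (here refl) (by (g∧L (here refl)) (weakenᴰ swap-⊆ ⊆-refl (identity B)))))
  hilbert⇒derivable (axC {A} {B} c∈𝒜) = by (g→R (here refl)) (by (g∧L (here refl))
    (by (gM ((false , A) ∷ (false , B) ∷ []) (just (A ⋀ B)) ((λ ()) , (λ _ → c∈𝒜))
            ((here refl , λ ()) ∷ (there (here refl) , λ ()) ∷ []) (here refl))
        (by₂ (g∧R (here refl)) (identity A) (weakenᴰ swap-⊆ ⊆-refl (identity B)))))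
  hilbert⇒derivable (axN n∈𝒜) = by (gM [] (just ⊤') ((λ _ → n∈𝒜) , λ ()) [] (here refl)) (0 , g⊤ (here refl))
  hilbert⇒derivable (axP p∈𝒜) = by (g¬R (here refl))
    (by (gM [ false , ⊥' ] nothing (inj₁ p∈𝒜 , s≤s z≤n , (λ { (s≤s ()) }) , λ ()) ((here refl , λ ()) ∷ []) tt)
        (0 , g⊥ (here refl)))
  hilbert⇒derivable (axD {A} d∈𝒜) = by (g¬R (here refl)) (by (g∧L (here refl))
    (by (gM ((false , A) ∷ (false , ¬' A) ∷ []) nothing (inj₂ d∈𝒜 , s≤s z≤n , (λ { (s≤s (s≤s ())) }) , λ _ → inj₂ d∈𝒜)
            ((here refl , λ ()) ∷ (there (here refl) , λ ()) ∷ []) tt)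
        (by (g¬L (there (here refl))) (identity A))))
  hilbert⇒derivable (axT {A} t∈𝒜) = by (g→R (here refl)) (by (gT t∈𝒜 (here refl)) (identity A))
  hilbert⇒derivable (ax4 {A} 4∈𝒜) = by (g→R (here refl))
    (by (gM [ true , A ] (just (□ A)) (arity-one (□ A)) ((here refl , λ _ → 4∈𝒜) ∷ []) (here refl)) (identity (□ A)))
  hilbert⇒derivable (mp {A} {B} ⊢A⟶B ⊢A) =
    cutᴰ A (weakenᴰ (λ ()) (∷⁺ʳ _ (λ ())) (hilbert⇒derivable ⊢A)) (⟶-invert A B (hilbert⇒derivable ⊢A⟶B))
  hilbert⇒derivable (re {A} {B} ⊢A⟶B _) =
    by (g→R (here refl)) (□-rule A B (here refl) (here refl) (⟶-invert A B (hilbert⇒derivable ⊢A⟶B)))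

module SequentToLNS (𝒜 : AxSet) where
  open SequentCalculus 𝒜

  endCtx : List Seq → Ctx
  endCtx G = ctx G [] nothing

  contractˡ : ∀ S {x Γ Δ} → x ∈ Γ → LNS 𝒜 (S ⟦ x ∷ Γ ⇒ Δ ⟧) → LNS 𝒜 (S ⟦ Γ ⇒ Δ ⟧)
  contractˡ S {x} {Δ = Δ} x∈Γ d with ∈-∃++ x∈Γ
  ... | ys , zs , refl =
    exch S (x ∷ ys ++ zs) (ys ++ [ x ] ++ zs) Δ Δ (↭-sym (shift x ys zs)) ↭-refl
      (cL S (ys ++ zs) Δ x (exch S (x ∷ ys ++ [ x ] ++ zs) (x ∷ x ∷ ys ++ zs) Δ Δ (↭.prep x (shift x ys zs)) ↭-refl d))

  contractʳ : ∀ S {x Γ Δ} → x ∈ Δ → LNS 𝒜 (S ⟦ Γ ⇒ x ∷ Δ ⟧) → LNS 𝒜 (S ⟦ Γ ⇒ Δ ⟧)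
  contractʳ S {x} {Γ = Γ} x∈Δ d with ∈-∃++ x∈Δ
  ... | ys , zs , refl =
    exch S Γ Γ (x ∷ ys ++ zs) (ys ++ [ x ] ++ zs) ↭-refl (↭-sym (shift x ys zs))
      (cR S Γ (ys ++ zs) x (exch S Γ Γ (x ∷ ys ++ [ x ] ++ zs) (x ∷ x ∷ ys ++ zs) ↭-refl (↭.prep x (shift x ys zs)) d))

  weakenˡ* : ∀ S M {Γ Δ} → LNS 𝒜 (S ⟦ Γ ⇒ Δ ⟧) → LNS 𝒜 (S ⟦ M ++ Γ ⇒ Δ ⟧)
  weakenˡ* S [] d = d
  weakenˡ* S (x ∷ M) {Γ} {Δ} d = wL S (M ++ Γ) Δ x (weakenˡ* S M d)

  weakenʳ* : ∀ S M {Γ Δ} → LNS 𝒜 (S ⟦ Γ ⇒ Δ ⟧) → LNS 𝒜 (S ⟦ Γ ⇒ M ++ Δ ⟧)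
  weakenʳ* S [] d = d
  weakenʳ* S (x ∷ M) {Γ} {Δ} d = wR S Γ (M ++ Δ) x (weakenʳ* S M d)

  absorbˡ : ∀ S Γ' Γ {Δ} → Γ ⊆ Γ' → LNS 𝒜 (S ⟦ Γ' ++ Γ ⇒ Δ ⟧) → LNS 𝒜 (S ⟦ Γ' ⇒ Δ ⟧)
  absorbˡ S Γ' [] {Δ} _ d = exch S (Γ' ++ []) Γ' Δ Δ (↭-reflexive (++-identityʳ Γ')) ↭-refl d
  absorbˡ S Γ' (x ∷ Γ) {Δ} x∷Γ⊆Γ' d = absorbˡ S Γ' Γ (x∷Γ⊆Γ' ∘ there)
    (contractˡ S (∈-++⁺ˡ (x∷Γ⊆Γ' (here refl))) (exch S (Γ' ++ [ x ] ++ Γ) (x ∷ Γ' ++ Γ) Δ Δ (shift x Γ' Γ) ↭-refl d))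

  absorbʳ : ∀ S Δ' Δ {Γ} → Δ ⊆ Δ' → LNS 𝒜 (S ⟦ Γ ⇒ Δ' ++ Δ ⟧) → LNS 𝒜 (S ⟦ Γ ⇒ Δ' ⟧)
  absorbʳ S Δ' [] {Γ} _ d = exch S Γ Γ (Δ' ++ []) Δ' ↭-refl (↭-reflexive (++-identityʳ Δ')) d
  absorbʳ S Δ' (x ∷ Δ) {Γ} x∷Δ⊆Δ' d = absorbʳ S Δ' Δ (x∷Δ⊆Δ' ∘ there)
    (contractʳ S (∈-++⁺ˡ (x∷Δ⊆Δ' (here refl))) (exch S Γ Γ (Δ' ++ [ x ] ++ Δ) (x ∷ Δ' ++ Δ) ↭-refl (shift x Δ' Δ) d))

  LNS-⊆ : ∀ S {Γ Δ Γ' Δ'} → Γ ⊆ Γ' → Δ ⊆ Δ' → LNS 𝒜 (S ⟦ Γ ⇒ Δ ⟧) → LNS 𝒜 (S ⟦ Γ' ⇒ Δ' ⟧)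
  LNS-⊆ S {Γ} {Δ} {Γ'} {Δ'} Γ⊆Γ' Δ⊆Δ' d = absorbʳ S Δ' Δ Δ⊆Δ' (weakenʳ* S Δ' (absorbˡ S Γ' Γ Γ⊆Γ' (weakenˡ* S Γ' d)))

  release : ∀ G Γ Δ Σ Π u → Usable Γ u → LNS 𝒜 (lin (G ++ [ Γ ⇒ Δ ]) (released u ∷ Σ ⇒ Π)) → LNS 𝒜 (linm G (Γ ⇒ Δ) (Σ ⇒ Π))
  release G Γ Δ Σ Π (false , Y) (□Y∈Γ , _) d = contractˡ (nonm (ctx G [] (just (Σ ⇒ Π)))) □Y∈Γ (□Lm G Γ Δ Σ Π Y d)
  release G Γ Δ Σ Π (true , Y) (□Y∈Γ , 4∈𝒜) d = contractˡ (nonm (ctx G [] (just (Σ ⇒ Π)))) □Y∈Γ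
      (rule4 G Γ Δ Σ Π Y (4∈𝒜 refl) d)

  DerivableFrom : List Seq → List Fm → List Fm → List Fm → Set
  DerivableFrom G M Σ Π = ∀ Σ' → M ++ Σ ⊆ Σ' → LNS 𝒜 (lin G (Σ' ⇒ Π))

  -- The boxed formulas are moved into the last component one at a time,
  -- rule C reopening the /ₘ-component between two of them.
  releaseAll : ∀ G Γ Δ Π us Σ → All (Usable Γ) us → (2 ≤ length us → 𝒜 C ≡ true) → 1 ≤ length us →
               DerivableFrom (G ++ [ Γ ⇒ Δ ]) (map released us) Σ Π → LNS 𝒜 (linm G (Γ ⇒ Δ) (Σ ⇒ Π))
  releaseAll G Γ Δ Π (u ∷ []) Σ (ok ∷ []) _ _ k = release G Γ Δ Σ Π u ok (k (released u ∷ Σ) ⊆-refl)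
  releaseAll G Γ Δ Π (u ∷ u' ∷ us) Σ (ok ∷ oks) c∈𝒜 _ k =
    release G Γ Δ Σ Π u ok (ruleC G (Γ ⇒ Δ) (released u ∷ Σ) Π (c∈𝒜 (s≤s (s≤s z≤n)))
      (releaseAll G Γ Δ Π (u' ∷ us) (released u ∷ Σ) oks (λ _ → c∈𝒜 (s≤s (s≤s z≤n))) (s≤s z≤n)
        (λ Σ' incl → k Σ' (incl ∘ unshift-⊆ (released u) (map released (u' ∷ us))))))

  simulate-□R : ∀ G Γ Δ B us → ModalArity (just B) (length us) → All (Usable Γ) us → □ B ∈ Δ →
                (∀ G' → LNS 𝒜 (lin G' (map released us ⇒ [ B ]))) → LNS 𝒜 (lin G (Γ ⇒ Δ))
  simulate-□R G Γ Δ B [] arity _ □B∈Δ premise =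
    contractʳ (nonm (endCtx G)) □B∈Δ (□Rm G Γ Δ B (ruleN G (Γ ⇒ Δ) [] [ B ] (proj₁ arity refl) (premise (G ++ [ Γ ⇒ Δ ]))))
  simulate-□R G Γ Δ B (u ∷ us) arity oks □B∈Δ premise = contractʳ (nonm (endCtx G)) □B∈Δ (□Rm G Γ Δ B
    (releaseAll G Γ Δ [ B ] (u ∷ us) [] oks (proj₂ arity) (s≤s z≤n)
      (λ Σ' incl → LNS-⊆ (nonm (endCtx _)) (incl ∘ ∈-++⁺ˡ) ⊆-refl (premise _))))

  data PlainPick (Γ : List Fm) (us : List BoxUse) : Set where
    allBoxed : map released us ⊆ Γ → PlainPick Γ us
    plain : ∀ A rest → □ A ∈ Γ → All (Usable Γ) rest → suc (length rest) ≡ length us →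
            map released us ⊆ A ∷ map released rest → PlainPick Γ us

  pickPlain : ∀ {Γ} us → All (Usable Γ) us → PlainPick Γ us
  pickPlain [] [] = allBoxed (λ ())
  pickPlain ((false , A) ∷ us) ((□A∈Γ , _) ∷ oks) = plain A us □A∈Γ oks refl ⊆-refl
  pickPlain ((true , A) ∷ us) ((□A∈Γ , q) ∷ oks) with pickPlain us oks
  ... | allBoxed us⊆Γ = allBoxed (∈-∷⁺ʳ □A∈Γ us⊆Γ)
  ... | plain B rest □B∈Γ okr len us⊆ = plain B ((true , A) ∷ rest) □B∈Γ ((□A∈Γ , q) ∷ okr) (cong suc len)
                                          (swap-⊆ ∘ ∷⁺ʳ _ us⊆)

  -- Rule D takes one plain formula A into the /ₘ-component; the others follow
  -- by □L/4 and C.  Boxed uses need no modal step at all.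
  simulate-D : ∀ G Γ Δ us → 𝒜 D ≡ true → (3 ≤ length us → 𝒜 C ≡ true) → All (Usable Γ) us →
               (∀ G' → LNS 𝒜 (lin G' (map released us ⇒ []))) → LNS 𝒜 (lin G (Γ ⇒ Δ))
  simulate-D G Γ Δ us d∈𝒜 c∈𝒜 oks premise with pickPlain us oks
  ... | allBoxed us⊆Γ = LNS-⊆ (nonm (endCtx G)) us⊆Γ (λ ()) (premise G)
  ... | plain A [] □A∈Γ _ _ us⊆ = contractˡ (nonm (endCtx G)) □A∈Γ (ruleD G Γ Δ A d∈𝒜
          (release G Γ Δ [ A ] [] (false , A) (□A∈Γ , λ ())
              (LNS-⊆ (nonm (endCtx _)) (∷⁺ʳ _ (λ ()) ∘ us⊆) ⊆-refl (premise _))))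
  ... | plain A (u ∷ rest) □A∈Γ okr len us⊆ = contractˡ (nonm (endCtx G)) □A∈Γ (ruleD G Γ Δ A d∈𝒜
          (releaseAll G Γ Δ [] (u ∷ rest) [ A ] okr (λ h → c∈𝒜 (subst (3 ≤_) len (s≤s h))) (s≤s z≤n)
            (λ Σ' incl → LNS-⊆ (nonm (endCtx _)) (incl ∘ ⊆-reflexive-↭ (∷↭∷ʳ A (map released (u ∷ rest))) ∘ us⊆) ⊆-refl
                (premise _))))

  C-or-D : ∀ n → (3 ≤ n → 𝒜 C ≡ true) → (n ≡ 2 → 𝒜 C ≡ true ⊎ 𝒜 D ≡ true) →
           (2 ≤ n → 𝒜 C ≡ true) ⊎ (𝒜 D ≡ true × (3 ≤ n → 𝒜 C ≡ true))
  C-or-D zero _ _ = inj₁ (λ ())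
  C-or-D (suc zero) _ _ = inj₁ (λ { (s≤s ()) })
  C-or-D (suc (suc zero)) _ two with two refl
  ... | inj₁ c∈𝒜 = inj₁ (λ _ → c∈𝒜)
  ... | inj₂ d∈𝒜 = inj₂ (d∈𝒜 , λ { (s≤s (s≤s ())) })
  C-or-D (suc (suc (suc n))) three _ = inj₁ (λ _ → three (s≤s (s≤s (s≤s z≤n))))

  simulate-⊥ : ∀ G Γ Δ us → ModalArity nothing (length us) → All (Usable Γ) us →
               (∀ G' → LNS 𝒜 (lin G' (map released us ⇒ []))) → LNS 𝒜 (lin G (Γ ⇒ Δ))
  simulate-⊥ G Γ Δ us (inj₂ d∈𝒜 , _ , three , _) oks premise = simulate-D G Γ Δ us d∈𝒜 three oks premise
  simulate-⊥ G Γ Δ us (inj₁ p∈𝒜 , nonempty , three , two) oks premise with C-or-D (length us) three two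
  ... | inj₁ c∈𝒜 = ruleP G Γ Δ p∈𝒜 (releaseAll G Γ Δ [] us [] oks c∈𝒜 nonempty
          (λ Σ' incl → LNS-⊆ (nonm (endCtx _)) (incl ∘ ∈-++⁺ˡ) ⊆-refl (premise _)))
  ... | inj₂ (d∈𝒜 , three') = simulate-D G Γ Δ us d∈𝒜 three' oks premise

  sequent⇒LNS : ∀ {n Γ Δ} → Der n Γ Δ → ∀ G → LNS 𝒜 (lin G (Γ ⇒ Δ))
  sequent⇒LNS (gax p i j) G = contractˡ (nonm (endCtx G)) i (contractʳ (nonm (endCtx G)) j (init (endCtx G) _ _ p))
  sequent⇒LNS (g⊥ i) G = contractˡ (nonm (endCtx G)) i (⊥L (endCtx G) _ _)
  sequent⇒LNS (g⊤ j) G = contractʳ (nonm (endCtx G)) j (⊤R (endCtx G) _ _)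
  sequent⇒LNS (g¬L i d) G = contractˡ (nonm (endCtx G)) i (¬L (endCtx G) _ _ _ (sequent⇒LNS d G))
  sequent⇒LNS (g¬R j d) G = contractʳ (nonm (endCtx G)) j (¬R (endCtx G) _ _ _ (sequent⇒LNS d G))
  sequent⇒LNS (g∧L i d) G = contractˡ (nonm (endCtx G)) i (∧L (endCtx G) _ _ _ _ (sequent⇒LNS d G))
  sequent⇒LNS (g∧R j d e) G = contractʳ (nonm (endCtx G)) j (∧R (endCtx G) _ _ _ _ (sequent⇒LNS d G) (sequent⇒LNS e G))
  sequent⇒LNS (g∨L i d e) G = contractˡ (nonm (endCtx G)) i (∨L (endCtx G) _ _ _ _ (sequent⇒LNS d G) (sequent⇒LNS e G))
  sequent⇒LNS (g∨R j d) G = contractʳ (nonm (endCtx G)) j (∨R (endCtx G) _ _ _ _ (sequent⇒LNS d G))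
  sequent⇒LNS (g→L i d e) G = contractˡ (nonm (endCtx G)) i (→L (endCtx G) _ _ _ _ (sequent⇒LNS d G) (sequent⇒LNS e G))
  sequent⇒LNS (g→R j d) G = contractʳ (nonm (endCtx G)) j (→R (endCtx G) _ _ _ _ (sequent⇒LNS d G))
  sequent⇒LNS {Γ = Γ} {Δ} (gT {X = X} t∈𝒜 i d) G =
    contractˡ (nonm (endCtx G)) i (ruleT G [ □ X ] [] Γ Δ t∈𝒜 (□Lm G [] [] Γ Δ X (sequent⇒LNS d (G ++ [ [] ⇒ [] ]))))
  sequent⇒LNS {Γ = Γ} {Δ} (gM us (just B) arity oks □B∈Δ d) G = simulate-□R G Γ Δ B us arity oks □B∈Δ (sequent⇒LNS d)
  sequent⇒LNS {Γ = Γ} {Δ} (gM us nothing arity oks _ d) G = simulate-⊥ G Γ Δ us arity oks (sequent⇒LNS d)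

mainTheorem12 : (𝒜 : AxSet) (A : Fm) →
    (Thm 𝒜 A → LNS 𝒜 (lin [] ([] ⇒ [ A ]))) × (LNS 𝒜 (lin [] ([] ⇒ [ A ])) → Thm 𝒜 A)
mainTheorem12 𝒜 A = completeness , Soundness.soundness 𝒜 A
  where
  completeness : Thm 𝒜 A → LNS 𝒜 (lin [] ([] ⇒ [ A ]))
  completeness ⊢A = SequentToLNS.sequent⇒LNS 𝒜 (proj₂ (HilbertToSequent.hilbert⇒derivable 𝒜 ⊢A)) []
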